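{- For positive integers $n\ge k$ and $1\le i\le n-k$, the coefficient $a_{n,k}^{(i)}$ of $z^i$ in $\mathrm{JS}_n^k(z)$ equals the number of ordered pairs $(Q_1,Q_2)$ of simply hooked $k$-quasi-permutations of $[n]$ such that $Q_1^-=Q_2^-$, $|Q_1^-|=|Q_2^-|=i$, and $\mathrm{pr}_y(Q_1)=\mathrm{pr}_y(Q_2)$.
   Context: The Jacobi–Stirling numbers of the second kind $\mathrm{JS}_n^k(z)$ are the polynomials in $z$ defined by $x^n=\sum_{k=0}^n \mathrm{JS}_n^k(z)\prod_{i=0}^{k-1}(x-i(z+i))$; equivalently $\mathrm{JS}_0^0=1$, $\mathrm{JS}_n^k=0$ for $n\ge1$, $k\notin\{1,\dots,n\}$, and $\mathrm{JS}_n^k(z)=\mathrm{JS}_{n-1}^{k-1}(z)+k(k+z)\mathrm{JS}_{n-1}^k(z)$ for $n,k\ge1$. Write $\mathrm{JS}_n^k(z)=\sum_{i=0}^{n-k}a_{n,k}^{(i)}z^i$. Let $[n]=\{1,\dots,n\}$. A permutation $\sigma$ of $[n]$ is identified with its diagram $\mathcal D(\sigma)=\{(i,\sigma(i)):i\in[n]\}$. For $Q\subseteq[n]\times[n]$, $\mathrm{pr}_x(Q)=\{i:(i,j)\in Q\}$, $\mathrm{pr}_y(Q)=\{j:(i,j)\in Q\}$, $Q^+=\{(i,j)\in Q:i\le j\}$, $Q^-=\{(i,j)\in Q:i\ge j\}$. A simply hooked $k$-quasi-permutation of $[n]$ is a subset $Q\subseteq[n]\times[n]$ such that $Q\subseteq\mathcal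 D(\sigma)$ for some permutation $\sigma$ of $[n]$, $|Q|=n-k$, and $\mathrm{pr}_x(Q^-)\cap\mathrm{pr}_y(Q^+)=\emptyset$. -}

module Defs where

open import Data.Nat using (ℕ; zero; suc; _+_; _*_; _∸_; _≤ᵇ_)
open import Data.Nat.Properties using () renaming (_≟_ to _≟ℕ_)
open import Data.Bool.Properties using () renaming (_≟_ to _≟B_)
open import Data.Product using (proj₁; proj₂)
open import Data.Bool using (Bool; true; false; _∧_; _∨_; not; if_then_else_)
open import Data.List using (List; []; _∷_; map; concatMap; length; filter; allFin; sum; cartesianProduct)
open import Data.Vec using (Vec; []; _∷_; lookup; tabulate)
open import Data.Fin using (Fin; toℕ)
open import Data.Fin.Properties using (_≟_)
open import Data.Bool.ListAction using (and; or)
open import Relation.Nullary.Decidable using (⌊_⌋)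
open import Relation.Unary using (Decidable)
open import Data.Bool.Properties using (T?)

-- Polynomials in z with ℕ coefficients, as coefficient lists
-- (head = constant term).

Poly : Set
Poly = List ℕ

_⊕_ : Poly → Poly → Poly
[] ⊕ q = q
(a ∷ p) ⊕ [] = a ∷ p
(a ∷ p) ⊕ (b ∷ q) = (a + b) ∷ (p ⊕ q)

scale : ℕ → Poly → Poly
scale c = map (c *_)

shiftZ : Poly → Poly
shiftZ p = 0 ∷ p

coeff : Poly → ℕ → ℕ
coeff [] i = 0
coeff (a ∷ p) zero = a
coeff (a ∷ p) (suc i) = coeff p i

-- Jacobi–Stirling numbers of the second kind JS n k (z):
-- JS 0 0 = 1, JS n k = 0 for n ≥ 1 and k ∉ {1..n} (in particular JS n 0 = 0),
-- JS n k = JS (n-1) (k-1) + k(k+z) JS (n-1) k.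
-- (For k > n the recurrence yields 0 automatically.)
JS : ℕ → ℕ → Poly
JS zero zero = 1 ∷ []
JS zero (suc k) = []
JS (suc n) zero = []
JS (suc n) (suc k) =
  JS n k ⊕ (scale (suc k * suc k) (JS n (suc k)) ⊕ scale (suc k) (shiftZ (JS n (suc k))))

a : ℕ → ℕ → ℕ → ℕ
a n k i = coeff (JS n k) i

-- Finite enumerations.  [n] is modelled by Fin n (element m ↦ m+1;
-- order preserved).

vecsOver : {A : Set} → List A → (n : ℕ) → List (Vec A n)
vecsOver xs zero = [] ∷ []
vecsOver xs (suc n) = concatMap (λ x → map (x ∷_) (vecsOver xs n)) xs

anyFin : (n : ℕ) → (Fin n → Bool) → Bool
anyFin n p = or (map p (allFin n))

allFin? : (n : ℕ) → (Fin n → Bool) → Bool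
allFin? n p = and (map p (allFin n))

_==_ : {n : ℕ} → Fin n → Fin n → Bool
x == y = ⌊ x ≟ y ⌋

_≤F_ : {n : ℕ} → Fin n → Fin n → Bool
x ≤F y = toℕ x ≤ᵇ toℕ y

isPerm : {n : ℕ} → Vec (Fin n) n → Bool
isPerm {n} σ =
  allFin? n (λ i → allFin? n (λ j → not (lookup σ i == lookup σ j) ∨ (i == j)))
  ∧ allFin? n (λ y → anyFin n (λ i → lookup σ i == y))

permutations : (n : ℕ) → List (Vec (Fin n) n)
permutations n = filter (λ σ → T? (isPerm σ)) (vecsOver (allFin n) n)

-- Subsets Q ⊆ [n] × [n], as characteristic matrices: (i , j) ∈ Q iff
-- lookup (lookup Q i) j ≡ true.

Rel : ℕ → Set
Rel n = Vec (Vec Bool n) n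

allRels : (n : ℕ) → List (Rel n)
allRels n = vecsOver (vecsOver (true ∷ false ∷ []) n) n

mem : {n : ℕ} → Rel n → Fin n → Fin n → Bool
mem Q i j = lookup (lookup Q i) j

card : {n : ℕ} → Rel n → ℕ
card {n} Q = length (filter (λ p → T? p) (concatMap (λ i → map (λ j → mem Q i j) (allFin n)) (allFin n)))

inSomePermDiagram : {n : ℕ} → Rel n → Bool
inSomePermDiagram {n} Q =
  or (map (λ σ → allFin? n (λ i → allFin? n (λ j → not (mem Q i j) ∨ (lookup σ i == j))))
          (permutations n))

plus : {n : ℕ} → Rel n → Rel n
plus Q = tabulate (λ i → tabulate (λ j → mem Q i j ∧ (i ≤F j)))

minus : {n : ℕ} → Rel n → Rel n
minus Q = tabulate (λ i → tabulate (λ j → mem Q i j ∧ (j ≤F i)))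

inPrX : {n : ℕ} → Rel n → Fin n → Bool
inPrX {n} Q x = anyFin n (λ j → mem Q x j)

inPrY : {n : ℕ} → Rel n → Fin n → Bool
inPrY {n} Q y = anyFin n (λ i → mem Q i y)

hookCondition : {n : ℕ} → Rel n → Bool
hookCondition {n} Q = allFin? n (λ x → not (inPrX (minus Q) x ∧ inPrY (plus Q) x))

isSHQP : (n k : ℕ) → Rel n → Bool
isSHQP n k Q = inSomePermDiagram Q ∧ ⌊ card Q ≟ℕ (n ∸ k) ⌋ ∧ hookCondition Q

eqRel : {n : ℕ} → Rel n → Rel n → Bool
eqRel {n} Q R = allFin? n (λ i → allFin? n (λ j → ⌊ mem Q i j ≟B mem R i j ⌋))

eqPrY : {n : ℕ} → Rel n → Rel n → Bool
eqPrY {n} Q R = allFin? n (λ y → ⌊ inPrY Q y ≟B inPrY R y ⌋)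

goodPair : (n k i : ℕ) → Rel n → Rel n → Bool
goodPair n k i Q₁ Q₂ =
  isSHQP n k Q₁ ∧ isSHQP n k Q₂
  ∧ eqRel (minus Q₁) (minus Q₂)
  ∧ ⌊ card (minus Q₁) ≟ℕ i ⌋ ∧ ⌊ card (minus Q₂) ≟ℕ i ⌋
  ∧ eqPrY Q₁ Q₂

countPairs : (n k i : ℕ) → ℕ
countPairs n k i =
  length (filter (λ pr → T? (goodPair n k i (proj₁ pr) (proj₂ pr)))
                 (cartesianProduct (allRels n) (allRels n)))

-- Both sides satisfy the same recurrence in n.  Split a matrix on [n+1] into its restriction
-- to [n] and its border: last column, last row and corner.  The hook condition at the new
-- index n+1 rules out the corner and rules out entries in both the last row and the last
-- column, so a simply hooked quasi-permutation has no new entry, one new entry in the last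
-- column (at one of the k free rows), or one in the last row (at one of the k free columns).
-- Since Q₁⁻ = Q₂⁻ and pr_y(Q₁) = pr_y(Q₂), both borders have the same shape, and in the last
-- case the same entry, which lies in Q⁻.  Counting the three cases gives, for the number
-- c(n, k, i) of pairs in the statement,
--   c(n+1, k+1, i) = c(n, k, i) + (k+1)² c(n, k+1, i) + (k+1) c(n, k+1, i-1),
-- the recurrence satisfied by the coefficients of JS.

module Submission where

open import Defs
open import Data.Bool.Base using (Bool; true; false; _∧_; _∨_; not)
open import Data.Bool.Properties
  using (T?; T-≡; ∧-conicalˡ; ∧-conicalʳ; ∨-identityʳ; ∨-zeroʳ; ∧-zeroʳ; ∧-identityʳ; ¬-not; not-injective)
  renaming (_≟_ to _≟ᴮ_)
open import Data.Bool.ListAction using (and; or)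
open import Data.Empty using (⊥; ⊥-elim)
open import Data.Fin.Base using (Fin; zero; suc; toℕ; fromℕ; inject₁; punchIn; punchOut)
  renaming (_≤_ to _≤ᶠ_)
open import Data.Fin.Properties
  using ( toℕ-inject₁; toℕ-fromℕ; inject₁-injective; fromℕ≢inject₁; any?; inject₁ℕ<; toℕ≤pred[n]
        ; punchIn-injective; punchIn-punchOut; punchInᵢ≢i)
  renaming (_≟_ to _≟ᶠ_)
open import Data.Fin.Relation.Unary.Top using (view; ‵fromℕ; ‵inject₁)
open import Data.Fin.Permutation using (Permutation′; _⟨$⟩ʳ_; _⟨$⟩ˡ_; inverseˡ; inverseʳ; insert; insert-punchIn)
  renaming (id to idₚ)
open import Data.List.Base using (List; []; _∷_; _++_; map; concatMap; length; filter; tabulate; allFin; cartesianProduct)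
open import Data.List.Properties using (map-tabulate)
open import Data.List.Membership.Propositional using (_∈_; lose; find)
open import Data.List.Membership.Propositional.Properties using (∈-map⁺; ∈-concatMap⁺; ∈-filter⁺; ∈-filter⁻; ∈-allFin)
open import Data.List.Relation.Unary.Any using (here)
open import Data.List.Relation.Unary.Any.Properties using (any⁺; any⁻)
open import Data.Nat.Base using (ℕ; zero; suc; _+_; _*_; _∸_; _≤_; _<_)
open import Data.Nat.Properties
open import Data.Nat.Solver using (module +-*-Solver)
open +-*-Solver using (solve; _:+_; _:=_; con)
open import Algebra.Properties.CommutativeMonoid.Sum +-0-commutativeMonoid
  using (sum; sum-syntax; ∑-comm; ∑-distrib-+; sum-cong-≗; sum-init-last; sum-replicate-zero; sum-remove)
open import Algebra.Properties.CommutativeSemigroup +-commutativeSemigroup using (interchange)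
open import Data.Product.Base using (Σ-syntax; ∃; _×_; _,_; proj₁; proj₂)
open import Data.Sum.Base using (_⊎_; inj₁; inj₂)
open import Data.Vec.Base using (Vec; []; _∷_; lookup; _∷ʳ_; zipWith)
import Data.Vec.Base as Vec
open import Data.Vec.Properties using (lookup∘tabulate; lookup-zipWith)
open import Function.Base using (_∘_; id; case_of_)
open import Function.Bundles using (Equivalence)
open import Relation.Binary.PropositionalEquality
open import Relation.Nullary.Decidable using (Dec; yes; no; ⌊_⌋)

private variable
  A B : Set
  n : ℕ

𝟙 : Bool → ℕ
𝟙 true  = 1
𝟙 false = 0

𝟙-∧ : ∀ a b → 𝟙 (a ∧ b) ≡ 𝟙 a * 𝟙 b
𝟙-∧ true  b = sym (+-identityʳ (𝟙 b))
𝟙-∧ false b = refl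

true≢false : true ≢ false
true≢false ()

∧-split : {a b : Bool} → a ∧ b ≡ true → a ≡ true × b ≡ true
∧-split {true} h = refl , h

∧₃-split : (a b : Bool) {c : Bool} → a ∧ b ∧ c ≡ true → a ≡ true × b ≡ true × c ≡ true
∧₃-split true true h = refl , refl , h

≡true-ext : {a b : Bool} → (a ≡ true → b ≡ true) → (b ≡ true → a ≡ true) → a ≡ b
≡true-ext {true}  {true}  _ _ = refl
≡true-ext {true}  {false} f _ = sym (f refl)
≡true-ext {false} {true}  _ g = g refl
≡true-ext {false} {false} _ _ = refl

∨-cancelʳ-false : {a a′ x x′ : Bool} → x ≡ false → x′ ≡ false → (a ∨ x) ≡ (a′ ∨ x′) → a ≡ a′
∨-cancelʳ-false {a} {a′} refl refl h = trans (sym (∨-identityʳ a)) (trans h (∨-identityʳ a′))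

⌊⌋-sound : {P : Set} (d : Dec P) → ⌊ d ⌋ ≡ true → P
⌊⌋-sound (yes p) _ = p

⌊⌋-complete : {P : Set} (d : Dec P) → P → ⌊ d ⌋ ≡ true
⌊⌋-complete (yes _) _ = refl
⌊⌋-complete (no ¬p) p = ⊥-elim (¬p p)

⌊⌋-false : {P : Set} (d : Dec P) → (P → ⊥) → ⌊ d ⌋ ≡ false
⌊⌋-false (yes p) ¬p = ⊥-elim (¬p p)
⌊⌋-false (no _)  ¬p = refl

⌊⌋-cong : {P P′ : Set} (d : Dec P) (d′ : Dec P′) → (P → P′) → (P′ → P) → ⌊ d ⌋ ≡ ⌊ d′ ⌋
⌊⌋-cong (yes p) (yes _) _ _  = refl
⌊⌋-cong (yes p) (no ¬p′) f _ = ⊥-elim (¬p′ (f p))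
⌊⌋-cong (no ¬p) (yes p′) _ g = ⊥-elim (¬p (g p′))
⌊⌋-cong (no _)  (no _)   _ _ = refl

𝟙-trichotomy : {f x y z : Bool} →
  (f ≡ true → x ≡ true ⊎ y ≡ true ⊎ z ≡ true) →
  (x ≡ true → f ≡ true) → (y ≡ true → f ≡ true) → (z ≡ true → f ≡ true) →
  (x ≡ true → y ≡ true → ⊥) → (x ≡ true → z ≡ true → ⊥) → (y ≡ true → z ≡ true → ⊥) →
  𝟙 f ≡ 𝟙 x + 𝟙 y + 𝟙 z
𝟙-trichotomy {f} {true}  {y}     {z}     _  x⇒f _   _   x∧y x∧z _
  rewrite x⇒f refl | ¬-not (x∧y refl) | ¬-not (x∧z refl) = refl
𝟙-trichotomy {f} {false} {true}  {z}     _  _   y⇒f _   _   _   y∧z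
  rewrite y⇒f refl | ¬-not (y∧z refl) = refl
𝟙-trichotomy {f} {false} {false} {true}  _  _   _   z⇒f _   _   _
  rewrite z⇒f refl = refl
𝟙-trichotomy {false} {false} {false} {false} _ _ _ _ _ _ _ = refl
𝟙-trichotomy {true}  {false} {false} {false} f⇒ _ _ _ _ _ _ with f⇒ refl
... | inj₁ ()
... | inj₂ (inj₁ ())
... | inj₂ (inj₂ ())

*-𝟙-cong : (b : Bool) {x y : ℕ} → (b ≡ true → x ≡ y) → x * 𝟙 b ≡ y * 𝟙 b
*-𝟙-cong true  x≡y = cong (_* 1) (x≡y refl)
*-𝟙-cong false {x} {y} _ = trans (*-zeroʳ x) (sym (*-zeroʳ y))

sumOver : List A → (A → ℕ) → ℕ
sumOver []       f = 0
sumOver (x ∷ xs) f = f x + sumOver xs f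

infixr 10 sumOver
syntax sumOver xs (λ x → e) = ∑[ x ∈ xs ] e

sumOver-cong : (xs : List A) {f g : A → ℕ} → (∀ x → f x ≡ g x) → sumOver xs f ≡ sumOver xs g
sumOver-cong []       f≗g = refl
sumOver-cong (x ∷ xs) f≗g = cong₂ _+_ (f≗g x) (sumOver-cong xs f≗g)

sumOver-zero : (xs : List A) → ∑[ x ∈ xs ] 0 ≡ 0
sumOver-zero []       = refl
sumOver-zero (x ∷ xs) = sumOver-zero xs

sumOver-++ : (xs ys : List A) (f : A → ℕ) → sumOver (xs ++ ys) f ≡ sumOver xs f + sumOver ys f
sumOver-++ []       ys f = refl
sumOver-++ (x ∷ xs) ys f = trans (cong (f x +_) (sumOver-++ xs ys f)) (sym (+-assoc (f x) _ _))

sumOver-distrib-+ : (xs : List A) (f g : A → ℕ) → ∑[ x ∈ xs ] (f x + g x) ≡ sumOver xs f + sumOver xs g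
sumOver-distrib-+ []       f g = refl
sumOver-distrib-+ (x ∷ xs) f g = begin
  (f x + g x) + (∑[ y ∈ xs ] (f y + g y))    ≡⟨ cong (f x + g x +_) (sumOver-distrib-+ xs f g) ⟩
  (f x + g x) + (sumOver xs f + sumOver xs g) ≡⟨ interchange (f x) (g x) _ _ ⟩
  (f x + sumOver xs f) + (g x + sumOver xs g) ∎
  where open ≡-Reasoning

*-distribˡ-sumOver : (c : ℕ) (xs : List A) (f : A → ℕ) → c * sumOver xs f ≡ ∑[ x ∈ xs ] (c * f x)
*-distribˡ-sumOver c []       f = *-zeroʳ c
*-distribˡ-sumOver c (x ∷ xs) f = trans (*-distribˡ-+ c (f x) _) (cong (c * f x +_) (*-distribˡ-sumOver c xs f))

*-distribʳ-sumOver : (c : ℕ) (xs : List A) (f : A → ℕ) → sumOver xs f * c ≡ ∑[ x ∈ xs ] (f x * c)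
*-distribʳ-sumOver c xs f = trans (*-comm (sumOver xs f) c)
  (trans (*-distribˡ-sumOver c xs f) (sumOver-cong xs λ x → *-comm c (f x)))

sumOver-map : (xs : List A) (g : A → B) (f : B → ℕ) → sumOver (map g xs) f ≡ ∑[ x ∈ xs ] f (g x)
sumOver-map []       g f = refl
sumOver-map (x ∷ xs) g f = cong (f (g x) +_) (sumOver-map xs g f)

sumOver-concatMap : (xs : List A) (g : A → List B) (f : B → ℕ) →
                    sumOver (concatMap g xs) f ≡ ∑[ x ∈ xs ] sumOver (g x) f
sumOver-concatMap []       g f = refl
sumOver-concatMap (x ∷ xs) g f =
  trans (sumOver-++ (g x) (concatMap g xs) f) (cong (sumOver (g x) f +_) (sumOver-concatMap xs g f))

sumOver-cartesianProduct : (xs : List A) (ys : List B) (f : A × B → ℕ) →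
                           sumOver (cartesianProduct xs ys) f ≡ ∑[ x ∈ xs ] ∑[ y ∈ ys ] f (x , y)
sumOver-cartesianProduct []       ys f = refl
sumOver-cartesianProduct (x ∷ xs) ys f =
  trans (sumOver-++ (map (x ,_) ys) _ f)
        (cong₂ _+_ (sumOver-map ys (x ,_) f) (sumOver-cartesianProduct xs ys f))

sumOver-comm : (xs : List A) (ys : List B) (f : A → B → ℕ) →
               ∑[ x ∈ xs ] ∑[ y ∈ ys ] f x y ≡ ∑[ y ∈ ys ] ∑[ x ∈ xs ] f x y
sumOver-comm []       ys f = sym (sumOver-zero ys)
sumOver-comm (x ∷ xs) ys f =
  trans (cong (sumOver ys (f x) +_) (sumOver-comm xs ys f))
        (sym (sumOver-distrib-+ ys (f x) (λ y → ∑[ x′ ∈ xs ] f x′ y)))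

sumOver²-distrib-+ : (xs : List A) (ys : List B) (f g : A → B → ℕ) →
  ∑[ x ∈ xs ] ∑[ y ∈ ys ] (f x y + g x y) ≡ ∑[ x ∈ xs ] ∑[ y ∈ ys ] f x y + ∑[ x ∈ xs ] ∑[ y ∈ ys ] g x y
sumOver²-distrib-+ xs ys f g = trans (sumOver-cong xs λ x → sumOver-distrib-+ ys (f x) (g x)) (sumOver-distrib-+ xs _ _)

*-distribˡ-sumOver² : (c : ℕ) (xs : List A) (ys : List B) (f : A → B → ℕ) →
  c * (∑[ x ∈ xs ] ∑[ y ∈ ys ] f x y) ≡ ∑[ x ∈ xs ] ∑[ y ∈ ys ] (c * f x y)
*-distribˡ-sumOver² c xs ys f =
  trans (*-distribˡ-sumOver c xs _) (sumOver-cong xs λ x → *-distribˡ-sumOver c ys (f x))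

length-filter≡count : (xs : List A) (p : A → Bool) →
                      length (filter (λ x → T? (p x)) xs) ≡ ∑[ x ∈ xs ] 𝟙 (p x)
length-filter≡count []       p = refl
length-filter≡count (x ∷ xs) p with p x
... | true  = cong suc (length-filter≡count xs p)
... | false = length-filter≡count xs p

count-∧-const : (xs : List A) (p : A → Bool) (b : Bool) →
                ∑[ x ∈ xs ] 𝟙 (p x ∧ b) ≡ (∑[ x ∈ xs ] 𝟙 (p x)) * 𝟙 b
count-∧-const xs p b =
  trans (sumOver-cong xs λ x → 𝟙-∧ (p x) b) (sym (*-distribʳ-sumOver (𝟙 b) xs (𝟙 ∘ p)))

count-dependent-∧ : (xs : List A) (ys : List B) (p : A → Bool) (q : A → B → Bool) {m : ℕ} →
                    (∀ x → ∑[ y ∈ ys ] 𝟙 (q x y) ≡ m) →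
                    ∑[ x ∈ xs ] ∑[ y ∈ ys ] 𝟙 (p x ∧ q x y) ≡ (∑[ x ∈ xs ] 𝟙 (p x)) * m
count-dependent-∧ xs ys p q {m} fibre = begin
  ∑[ x ∈ xs ] ∑[ y ∈ ys ] 𝟙 (p x ∧ q x y)
    ≡⟨ sumOver-cong xs (λ x → sumOver-cong ys λ y → 𝟙-∧ (p x) (q x y)) ⟩
  ∑[ x ∈ xs ] ∑[ y ∈ ys ] (𝟙 (p x) * 𝟙 (q x y))
    ≡⟨ sumOver-cong xs (λ x → sym (*-distribˡ-sumOver (𝟙 (p x)) ys (𝟙 ∘ q x))) ⟩
  ∑[ x ∈ xs ] (𝟙 (p x) * (∑[ y ∈ ys ] 𝟙 (q x y)))
    ≡⟨ sumOver-cong xs (λ x → cong (𝟙 (p x) *_) (fibre x)) ⟩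
  ∑[ x ∈ xs ] (𝟙 (p x) * m)
    ≡⟨ *-distribʳ-sumOver m xs (𝟙 ∘ p) ⟨
  (∑[ x ∈ xs ] 𝟙 (p x)) * m ∎
  where open ≡-Reasoning

count-dependent-∧-const : (xs : List A) (ys : List B) (p : A → Bool) (q : A → B → Bool) (b : Bool) {m : ℕ} →
                          (∀ x → ∑[ y ∈ ys ] 𝟙 (q x y) ≡ m) →
                          ∑[ x ∈ xs ] ∑[ y ∈ ys ] 𝟙 (p x ∧ q x y ∧ b) ≡ (∑[ x ∈ xs ] 𝟙 (p x)) * (m * 𝟙 b)
count-dependent-∧-const xs ys p q b fibre =
  count-dependent-∧ xs ys p (λ x y → q x y ∧ b) λ x → trans (count-∧-const ys (q x) b) (cong (_* 𝟙 b) (fibre x))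

sumOver-vecsOver-∷ : (xs : List A) (n : ℕ) (f : Vec A (suc n) → ℕ) →
                     sumOver (vecsOver xs (suc n)) f ≡ ∑[ x ∈ xs ] ∑[ v ∈ vecsOver xs n ] f (x ∷ v)
sumOver-vecsOver-∷ xs n f =
  trans (sumOver-concatMap xs _ f) (sumOver-cong xs λ x → sumOver-map (vecsOver xs n) (x ∷_) f)

sumOver-vecsOver-∷ʳ : (xs : List A) (n : ℕ) (f : Vec A (suc n) → ℕ) →
                      sumOver (vecsOver xs (suc n)) f ≡ ∑[ v ∈ vecsOver xs n ] ∑[ x ∈ xs ] f (v ∷ʳ x)
sumOver-vecsOver-∷ʳ xs zero    f =
  trans (sumOver-vecsOver-∷ xs zero f) (trans (sumOver-cong xs λ x → +-identityʳ (f (x ∷ []))) (sym (+-identityʳ _)))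
sumOver-vecsOver-∷ʳ xs (suc n) f = begin
  sumOver (vecsOver xs (suc (suc n))) f
    ≡⟨ sumOver-vecsOver-∷ xs (suc n) f ⟩
  ∑[ x ∈ xs ] ∑[ v ∈ vecsOver xs (suc n) ] f (x ∷ v)
    ≡⟨ sumOver-cong xs (λ x → sumOver-vecsOver-∷ʳ xs n (λ v → f (x ∷ v))) ⟩
  ∑[ x ∈ xs ] ∑[ v ∈ vecsOver xs n ] ∑[ y ∈ xs ] f (x ∷ (v ∷ʳ y))
    ≡⟨ sumOver-vecsOver-∷ xs n _ ⟨
  ∑[ v ∈ vecsOver xs (suc n) ] ∑[ y ∈ xs ] f (v ∷ʳ y) ∎
  where open ≡-Reasoning

sumOver-vecsOver-columns : (xs : List A) (n m : ℕ) (h : Vec (Vec A (suc n)) m → ℕ) →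
  sumOver (vecsOver (vecsOver xs (suc n)) m) h ≡
  ∑[ W ∈ vecsOver (vecsOver xs n) m ] ∑[ c ∈ vecsOver xs m ] h (zipWith _∷ʳ_ W c)
sumOver-vecsOver-columns xs n zero    h = sym (+-identityʳ _)
sumOver-vecsOver-columns xs n (suc m) h = begin
  sumOver (vecsOver Rows (suc m)) h
    ≡⟨ sumOver-vecsOver-∷ Rows m h ⟩
  ∑[ x ∈ Rows ] ∑[ V ∈ vecsOver Rows m ] h (x ∷ V)
    ≡⟨ sumOver-cong Rows (λ x → sumOver-vecsOver-columns xs n m (λ V → h (x ∷ V))) ⟩
  ∑[ x ∈ Rows ] ∑[ W ∈ vecsOver Rows′ m ] ∑[ c ∈ vecsOver xs m ] h (x ∷ zipWith _∷ʳ_ W c)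
    ≡⟨ sumOver-vecsOver-∷ʳ xs n _ ⟩
  ∑[ w ∈ Rows′ ] ∑[ y ∈ xs ] ∑[ W ∈ vecsOver Rows′ m ] ∑[ c ∈ vecsOver xs m ] h ((w ∷ʳ y) ∷ zipWith _∷ʳ_ W c)
    ≡⟨ sumOver-cong Rows′ (λ w → sumOver-comm xs (vecsOver Rows′ m) _) ⟩
  ∑[ w ∈ Rows′ ] ∑[ W ∈ vecsOver Rows′ m ] ∑[ y ∈ xs ] ∑[ c ∈ vecsOver xs m ] h ((w ∷ʳ y) ∷ zipWith _∷ʳ_ W c)
    ≡⟨ sumOver-cong Rows′ (λ w → sumOver-cong (vecsOver Rows′ m) λ W →
         sumOver-vecsOver-∷ xs m (λ c → h (zipWith _∷ʳ_ (w ∷ W) c))) ⟨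
  ∑[ w ∈ Rows′ ] ∑[ W ∈ vecsOver Rows′ m ] ∑[ c ∈ vecsOver xs (suc m) ] h (zipWith _∷ʳ_ (w ∷ W) c)
    ≡⟨ sumOver-vecsOver-∷ Rows′ m _ ⟨
  ∑[ W ∈ vecsOver Rows′ (suc m) ] ∑[ c ∈ vecsOver xs (suc m) ] h (zipWith _∷ʳ_ W c) ∎
  where
  open ≡-Reasoning
  Rows  = vecsOver xs (suc n)
  Rows′ = vecsOver xs n

bits : List Bool
bits = true ∷ false ∷ []

boolVecs : (n : ℕ) → List (Vec Bool n)
boolVecs = vecsOver bits

sumOver-boolVecs-suc : (f : Vec Bool (suc n) → ℕ) →
  sumOver (boolVecs (suc n)) f ≡ ∑[ v ∈ boolVecs n ] f (true ∷ v) + ∑[ v ∈ boolVecs n ] f (false ∷ v)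
sumOver-boolVecs-suc {n} f = trans (sumOver-vecsOver-∷ bits n f) (cong (sumOver (boolVecs n) (f ∘ (true ∷_)) +_) (+-identityʳ _))

lookup-∷ʳ-inject₁ : (xs : Vec A n) (x : A) (i : Fin n) → lookup (xs ∷ʳ x) (inject₁ i) ≡ lookup xs i
lookup-∷ʳ-inject₁ (y ∷ xs) x zero    = refl
lookup-∷ʳ-inject₁ (y ∷ xs) x (suc i) = lookup-∷ʳ-inject₁ xs x i

lookup-∷ʳ-fromℕ : (xs : Vec A n) (x : A) → lookup (xs ∷ʳ x) (fromℕ n) ≡ x
lookup-∷ʳ-fromℕ []       x = refl
lookup-∷ʳ-fromℕ (y ∷ xs) x = lookup-∷ʳ-fromℕ xs x

lookup-ext : (v w : Vec A n) → (∀ i → lookup v i ≡ lookup w i) → v ≡ w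
lookup-ext []      []      _   = refl
lookup-ext (x ∷ v) (y ∷ w) v≗w = cong₂ _∷_ (v≗w zero) (lookup-ext v w (v≗w ∘ suc))

∈-vecsOver : {xs : List A} → (∀ x → x ∈ xs) → (v : Vec A n) → v ∈ vecsOver xs n
∈-vecsOver all []      = here refl
∈-vecsOver all (x ∷ v) = ∈-concatMap⁺ _ (lose (all x) (∈-map⁺ (x ∷_) (∈-vecsOver all v)))

and-tabulate-sound : (p : Fin n → Bool) → and (tabulate p) ≡ true → ∀ x → p x ≡ true
and-tabulate-sound p h zero    = ∧-conicalˡ _ _ h
and-tabulate-sound p h (suc x) = and-tabulate-sound (p ∘ suc) (∧-conicalʳ (p zero) _ h) x

and-tabulate-complete : (p : Fin n → Bool) → (∀ x → p x ≡ true) → and (tabulate p) ≡ true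
and-tabulate-complete {zero}  p h = refl
and-tabulate-complete {suc n} p h = cong₂ _∧_ (h zero) (and-tabulate-complete (p ∘ suc) (h ∘ suc))

or-tabulate-sound : (p : Fin n → Bool) → or (tabulate p) ≡ true → ∃ λ x → p x ≡ true
or-tabulate-sound {suc n} p h with p zero in p0
... | true  = zero , p0
... | false = let (x , px) = or-tabulate-sound (p ∘ suc) h in suc x , px

or-tabulate-complete : (p : Fin n → Bool) (x : Fin n) → p x ≡ true → or (tabulate p) ≡ true
or-tabulate-complete p zero    px rewrite px = refl
or-tabulate-complete p (suc x) px with p zero
... | true  = refl
... | false = or-tabulate-complete (p ∘ suc) x px

module _ {p : Fin n → Bool} where

  allFin?-sound : allFin? n p ≡ true → ∀ x → p x ≡ true
  allFin?-sound h = and-tabulate-sound p (subst (λ ps → and ps ≡ true) (map-tabulate id p) h)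

  allFin?-complete : (∀ x → p x ≡ true) → allFin? n p ≡ true
  allFin?-complete h = subst (λ ps → and ps ≡ true) (sym (map-tabulate id p)) (and-tabulate-complete p h)

  anyFin-sound : anyFin n p ≡ true → ∃ λ x → p x ≡ true
  anyFin-sound h = or-tabulate-sound p (subst (λ ps → or ps ≡ true) (map-tabulate id p) h)

  anyFin-complete : (x : Fin n) → p x ≡ true → anyFin n p ≡ true
  anyFin-complete x px = subst (λ ps → or ps ≡ true) (sym (map-tabulate id p)) (or-tabulate-complete p x px)

  anyFin-false : (∀ x → p x ≡ false) → anyFin n p ≡ false
  anyFin-false h = ¬-not λ any-p → let (x , px) = anyFin-sound any-p in true≢false (trans (sym px) (h x))

  anyFin-false⁻ : anyFin n p ≡ false → ∀ x → p x ≡ false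
  anyFin-false⁻ h x = ¬-not λ px → true≢false (trans (sym (anyFin-complete x px)) h)

sumOver-tabulate : (g : Fin n → A) (f : A → ℕ) → sumOver (tabulate g) f ≡ ∑[ i < n ] f (g i)
sumOver-tabulate {zero}  g f = refl
sumOver-tabulate {suc n} g f = cong (f (g zero) +_) (sumOver-tabulate (g ∘ suc) f)

count : (Fin n → Bool) → ℕ
count {n} p = ∑[ x < n ] 𝟙 (p x)

sum-zero : {f : Fin n → ℕ} → (∀ x → f x ≡ 0) → sum f ≡ 0
sum-zero {n} f≗0 = trans (sum-cong-≗ f≗0) (sum-replicate-zero n)

sum-single : (f : Fin n → ℕ) (a : Fin n) → (∀ x → x ≢ a → f x ≡ 0) → sum f ≡ f a
sum-single {suc n} f a others =
  trans (sum-remove {i = a} f)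
        (trans (cong (f a +_) (sum-zero λ x → others (punchIn a x) (punchInᵢ≢i a x))) (+-identityʳ (f a)))

count-none : {p : Fin n → Bool} → (∀ x → p x ≡ false) → count p ≡ 0
count-none none = sum-zero λ x → cong 𝟙 (none x)

count≡0⇒none : (p : Fin n → Bool) → count p ≡ 0 → ∀ x → p x ≡ false
count≡0⇒none p h zero    with p zero
... | false = refl
count≡0⇒none p h (suc x) = count≡0⇒none (p ∘ suc) (m+n≡0⇒n≡0 (𝟙 (p zero)) h) x

count-unique : {p : Fin n → Bool} (a : Fin n) → p a ≡ true → (∀ x → p x ≡ true → x ≡ a) → count p ≡ 1
count-unique {p = p} a pa unique = trans (sum-single (𝟙 ∘ p) a others) (cong 𝟙 pa)
  where
  others : ∀ x → x ≢ a → 𝟙 (p x) ≡ 0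
  others x x≢a with p x in px
  ... | true  = ⊥-elim (x≢a (unique x px))
  ... | false = refl

count-not+count : (p : Fin n → Bool) → count (not ∘ p) + count p ≡ n
count-not+count {zero}  p = refl
count-not+count {suc n} p =
  trans (interchange (𝟙 (not (p zero))) (count (not ∘ p ∘ suc)) (𝟙 (p zero)) (count (p ∘ suc)))
        (cong₂ _+_ (𝟙-not+𝟙 (p zero)) (count-not+count (p ∘ suc)))
  where
  𝟙-not+𝟙 : ∀ a → 𝟙 (not a) + 𝟙 a ≡ 1
  𝟙-not+𝟙 true  = refl
  𝟙-not+𝟙 false = refl

count-not+size : {e k m : ℕ} (p : Fin n → Bool) → e ≡ count p → e + k ≡ m → count (not ∘ p) + m ≡ n + k
count-not+size {n} {e} {k} {m} p e≡count size = begin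
  count (not ∘ p) + m             ≡⟨ cong (count (not ∘ p) +_) size ⟨
  count (not ∘ p) + (e + k)       ≡⟨ +-assoc (count (not ∘ p)) e k ⟨
  count (not ∘ p) + e + k         ≡⟨ cong (λ x → count (not ∘ p) + x + k) e≡count ⟩
  count (not ∘ p) + count p + k   ≡⟨ cong (_+ k) (count-not+count p) ⟩
  n + k                           ∎
  where open ≡-Reasoning

≤F-sound : {x y : Fin n} → x ≤F y ≡ true → x ≤ᶠ y
≤F-sound {x = x} {y} h = ≤ᵇ⇒≤ (toℕ x) (toℕ y) (Equivalence.from T-≡ h)

≤F-complete : {x y : Fin n} → x ≤ᶠ y → x ≤F y ≡ true
≤F-complete x≤y = Equivalence.to T-≡ (≤⇒≤ᵇ x≤y)

==-refl : (x : Fin n) → x == x ≡ true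
==-refl x = ⌊⌋-complete (x ≟ᶠ x) refl

inject₁<fromℕ : (i : Fin n) → toℕ (inject₁ i) < toℕ (fromℕ n)
inject₁<fromℕ {n} i = subst (toℕ (inject₁ i) <_) (sym (toℕ-fromℕ n)) (inject₁ℕ< i)

≤fromℕ : (x : Fin (suc n)) → x ≤ᶠ fromℕ n
≤fromℕ {n} x = subst (toℕ x ≤_) (sym (toℕ-fromℕ n)) (toℕ≤pred[n] x)

fromℕ≰inject₁ : (i : Fin n) → fromℕ n ≤ᶠ inject₁ i → ⊥
fromℕ≰inject₁ i = <⇒≱ (inject₁<fromℕ i)

isNull : Vec Bool n → Bool
isNull []      = true
isNull (x ∷ v) = not x ∧ isNull v

isSingletonIn : (Fin n → Bool) → Vec Bool n → Bool
isSingletonIn P []          = false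
isSingletonIn P (true ∷ v)  = P zero ∧ isNull v
isSingletonIn P (false ∷ v) = isSingletonIn (P ∘ suc) v

_==ᵛ_ : Vec Bool n → Vec Bool n → Bool
[]      ==ᵛ []      = true
(x ∷ v) ==ᵛ (y ∷ w) = ⌊ x ≟ᴮ y ⌋ ∧ (v ==ᵛ w)

SingletonIn : (P v : Fin n → Bool) → Set
SingletonIn {n} P v = Σ[ a ∈ Fin n ] P a ≡ true × v a ≡ true × (∀ x → v x ≡ true → x ≡ a)

isNull-sound : (v : Vec Bool n) → isNull v ≡ true → ∀ j → lookup v j ≡ false
isNull-sound (false ∷ v) h zero    = refl
isNull-sound (false ∷ v) h (suc j) = isNull-sound v h j

isNull-complete : (v : Vec Bool n) → (∀ j → lookup v j ≡ false) → isNull v ≡ true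
isNull-complete []      _    = refl
isNull-complete (x ∷ v) null rewrite null zero = isNull-complete v (null ∘ suc)

isSingletonIn-sound : (P : Fin n → Bool) (v : Vec Bool n) → isSingletonIn P v ≡ true → SingletonIn P (lookup v)
isSingletonIn-sound P (true ∷ v) h = zero , ∧-conicalˡ _ _ h , refl , only
  where
  only : ∀ x → lookup (true ∷ v) x ≡ true → x ≡ zero
  only zero    _ = refl
  only (suc x) e = ⊥-elim (true≢false (trans (sym e) (isNull-sound v (∧-conicalʳ (P zero) _ h) x)))
isSingletonIn-sound P (false ∷ v) h =
  let (a , Pa , va , only) = isSingletonIn-sound (P ∘ suc) v h
  in suc a , Pa , va , λ { (suc x) e → cong suc (only x e) }

isSingletonIn-complete : (P : Fin n → Bool) (v : Vec Bool n) → SingletonIn P (lookup v) → isSingletonIn P v ≡ true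
isSingletonIn-complete P (true ∷ v) (zero , Pa , _ , only) =
  cong₂ _∧_ Pa (isNull-complete v λ j → ¬-not λ e → 0≢suc (only (suc j) e))
  where
  0≢suc : ∀ {j : Fin n} → suc j ≢ zero
  0≢suc ()
isSingletonIn-complete P (true ∷ v) (suc a , _ , _ , only) with only zero refl
... | ()
isSingletonIn-complete P (false ∷ v) (suc a , Pa , va , only) =
  isSingletonIn-complete (P ∘ suc) v (a , Pa , va , λ x e → suc-injective′ (only (suc x) e))
  where
  suc-injective′ : ∀ {x y : Fin n} → Fin.suc x ≡ suc y → x ≡ y
  suc-injective′ refl = refl

==ᵛ-sound : (v w : Vec Bool n) → v ==ᵛ w ≡ true → v ≡ w
==ᵛ-sound []      []      _ = refl
==ᵛ-sound (x ∷ v) (y ∷ w) h = cong₂ _∷_ (⌊⌋-sound (x ≟ᴮ y) (∧-conicalˡ _ _ h)) (==ᵛ-sound v w (∧-conicalʳ _ _ h))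

==ᵛ-refl : (v : Vec Bool n) → v ==ᵛ v ≡ true
==ᵛ-refl []      = refl
==ᵛ-refl (x ∷ v) = cong₂ _∧_ (⌊⌋-complete (x ≟ᴮ x) refl) (==ᵛ-refl v)

isNull⇒anyFin-false : (v : Vec Bool n) → isNull v ≡ true → anyFin n (lookup v) ≡ false
isNull⇒anyFin-false v h = anyFin-false (isNull-sound v h)

isSingletonIn⇒anyFin : (P : Fin n → Bool) (v : Vec Bool n) → isSingletonIn P v ≡ true → anyFin n (lookup v) ≡ true
isSingletonIn⇒anyFin P v h = let (a , _ , va , _) = isSingletonIn-sound P v h in anyFin-complete a va

count-isNull : ∑[ v ∈ boolVecs n ] 𝟙 (isNull v) ≡ 1
count-isNull {zero}  = refl
count-isNull {suc n} =
  trans (sumOver-boolVecs-suc {n} (λ v → 𝟙 (isNull v))) (cong₂ _+_ (sumOver-zero (boolVecs n)) (count-isNull {n}))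

count-==ᵛ : (w : Vec Bool n) → ∑[ v ∈ boolVecs n ] 𝟙 (v ==ᵛ w) ≡ 1
count-==ᵛ []                  = refl
count-==ᵛ {suc n} (true ∷ w)  =
  trans (sumOver-boolVecs-suc (λ v → 𝟙 (v ==ᵛ (true ∷ w)))) (cong₂ _+_ (count-==ᵛ w) (sumOver-zero (boolVecs n)))
count-==ᵛ {suc n} (false ∷ w) =
  trans (sumOver-boolVecs-suc (λ v → 𝟙 (v ==ᵛ (false ∷ w)))) (cong₂ _+_ (sumOver-zero (boolVecs n)) (count-==ᵛ w))

count-isSingletonIn : (P : Fin n → Bool) → ∑[ v ∈ boolVecs n ] 𝟙 (isSingletonIn P v) ≡ count P
count-isSingletonIn {zero}  P = refl
count-isSingletonIn {suc n} P =
  trans (sumOver-boolVecs-suc (λ v → 𝟙 (isSingletonIn P v))) (cong₂ _+_ first (count-isSingletonIn (P ∘ suc)))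
  where
  first : ∑[ v ∈ boolVecs n ] 𝟙 (P zero ∧ isNull v) ≡ 𝟙 (P zero)
  first with P zero
  ... | true  = count-isNull {n}
  ... | false = sumOver-zero (boolVecs n)

Mat : ℕ → Set
Mat n = Fin n → Fin n → Bool

entries : Mat n → ℕ
entries {n} M = ∑[ i < n ] ∑[ j < n ] 𝟙 (M i j)

entries-cong : {M N : Mat n} → (∀ i j → M i j ≡ N i j) → entries M ≡ entries N
entries-cong M≗N = sum-cong-≗ λ i → sum-cong-≗ λ j → cong 𝟙 (M≗N i j)

entries-last : (N : Mat (suc n)) →
  entries N ≡ entries (λ i j → N (inject₁ i) (inject₁ j))
              + (count (λ i → N (inject₁ i) (fromℕ n))
                 + (count (λ j → N (fromℕ n) (inject₁ j)) + 𝟙 (N (fromℕ n) (fromℕ n))))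
entries-last {n} N = begin
  ∑[ x < suc n ] ∑[ y < suc n ] 𝟙 (N x y)
    ≡⟨ sum-cong-≗ (λ x → sum-init-last (𝟙 ∘ N x)) ⟩
  ∑[ x < suc n ] (∑[ j < n ] 𝟙 (N x (I j)) + 𝟙 (N x L))
    ≡⟨ sum-init-last (λ x → ∑[ j < n ] 𝟙 (N x (I j)) + 𝟙 (N x L)) ⟩
  ∑[ i < n ] (∑[ j < n ] 𝟙 (N (I i) (I j)) + 𝟙 (N (I i) L)) + (∑[ j < n ] 𝟙 (N L (I j)) + 𝟙 (N L L))
    ≡⟨ cong (_+ (count (λ j → N L (I j)) + 𝟙 (N L L)))
            (∑-distrib-+ (λ i → ∑[ j < n ] 𝟙 (N (I i) (I j))) (λ i → 𝟙 (N (I i) L))) ⟩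
  (entries (λ i j → N (I i) (I j)) + count (λ i → N (I i) L)) + (count (λ j → N L (I j)) + 𝟙 (N L L))
    ≡⟨ +-assoc (entries (λ i j → N (I i) (I j))) _ _ ⟩
  entries (λ i j → N (I i) (I j)) + (count (λ i → N (I i) L) + (count (λ j → N L (I j)) + 𝟙 (N L L))) ∎
  where
  open ≡-Reasoning
  I = inject₁
  L = fromℕ n

card≡entries : (Q : Rel n) → card Q ≡ entries (mem Q)
card≡entries {n} Q = begin
  card Q
    ≡⟨ length-filter≡count (concatMap (λ i → map (mem Q i) (allFin n)) (allFin n)) id ⟩
  sumOver (concatMap (λ i → map (mem Q i) (allFin n)) (allFin n)) 𝟙
    ≡⟨ sumOver-concatMap (allFin n) _ 𝟙 ⟩
  ∑[ i ∈ allFin n ] sumOver (map (mem Q i) (allFin n)) 𝟙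
    ≡⟨ sumOver-cong (allFin n) (λ i → sumOver-map (allFin n) (mem Q i) 𝟙) ⟩
  ∑[ i ∈ allFin n ] ∑[ j ∈ allFin n ] 𝟙 (mem Q i j)
    ≡⟨ sumOver-tabulate id (λ i → ∑[ j ∈ allFin n ] 𝟙 (mem Q i j)) ⟩
  ∑[ i < n ] ∑[ j ∈ allFin n ] 𝟙 (mem Q i j)
    ≡⟨ sum-cong-≗ (λ i → sumOver-tabulate id (𝟙 ∘ mem Q i)) ⟩
  entries (mem Q) ∎
  where open ≡-Reasoning

lower : Mat n → Mat n
lower M x y = M x y ∧ (y ≤F x)

occupiedRow occupiedCol : Mat n → Fin n → Bool
occupiedRow {n} M x = anyFin n (λ y → M x y)
occupiedCol {n} M y = anyFin n (λ x → M x y)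

freeRow freeCol : Mat n → Fin n → Bool
freeRow M = not ∘ occupiedRow M
freeCol M = not ∘ occupiedCol M

mem-minus : (Q : Rel n) (x y : Fin n) → mem (minus Q) x y ≡ lower (mem Q) x y
mem-minus Q x y =
  trans (cong (λ row → lookup row y) (lookup∘tabulate (λ i → Vec.tabulate (λ j → lower (mem Q) i j)) x))
        (lookup∘tabulate (lower (mem Q) x) y)

mem-plus : (Q : Rel n) (x y : Fin n) → mem (plus Q) x y ≡ (mem Q x y ∧ (x ≤F y))
mem-plus Q x y =
  trans (cong (λ row → lookup row y) (lookup∘tabulate (λ i → Vec.tabulate (λ j → mem Q i j ∧ (i ≤F j))) x))
        (lookup∘tabulate (λ j → mem Q x j ∧ (x ≤F j)) y)

RowInjective ColInjective Hooked : Mat n → Set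
RowInjective M = ∀ i j j′ → M i j ≡ true → M i j′ ≡ true → j ≡ j′
ColInjective M = ∀ i i′ j → M i j ≡ true → M i′ j ≡ true → i ≡ i′
Hooked M = ∀ x i j → M x j ≡ true → j ≤ᶠ x → M i x ≡ true → i ≤ᶠ x → ⊥

module _ {M : Mat n} where

  freeRow-sound : ∀ {a} → freeRow M a ≡ true → ∀ j → M a j ≡ true → ⊥
  freeRow-sound free j Maj = true≢false (trans (sym (anyFin-complete j Maj)) (not-injective free))

  freeRow-complete : ∀ {a} → (∀ j → M a j ≡ true → ⊥) → freeRow M a ≡ true
  freeRow-complete empty = cong not (anyFin-false λ j → ¬-not (empty j))

  freeCol-sound : ∀ {j} → freeCol M j ≡ true → ∀ i → M i j ≡ true → ⊥
  freeCol-sound free i Mij = true≢false (trans (sym (anyFin-complete i Mij)) (not-injective free))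

  freeCol-complete : ∀ {j} → (∀ i → M i j ≡ true → ⊥) → freeCol M j ≡ true
  freeCol-complete empty = cong not (anyFin-false λ i → ¬-not (empty i))

entries≡count-occupiedRow : (M : Mat n) → RowInjective M → entries M ≡ count (occupiedRow M)
entries≡count-occupiedRow {n} M row-inj = sum-cong-≗ row-sum
  where
  row-sum : ∀ i → ∑[ j < n ] 𝟙 (M i j) ≡ 𝟙 (occupiedRow M i)
  row-sum i with occupiedRow M i in occupied
  ... | true  = let (j₀ , Mij₀) = anyFin-sound {p = M i} occupied in
    trans (sum-single (𝟙 ∘ M i) j₀ (λ j j≢j₀ → cong 𝟙 (¬-not λ Mij → j≢j₀ (row-inj i j j₀ Mij Mij₀))))
          (cong 𝟙 Mij₀)
  ... | false = count-none (anyFin-false⁻ {p = M i} occupied)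

entries≡count-occupiedCol : (M : Mat n) → ColInjective M → entries M ≡ count (occupiedCol M)
entries≡count-occupiedCol M col-inj =
  trans (∑-comm (λ i j → 𝟙 (M i j)))
        (entries≡count-occupiedRow (λ i j → M j i) (λ j i i′ e e′ → col-inj i i′ j e e′))

hookCondition-sound : (Q : Rel n) → hookCondition Q ≡ true → Hooked (mem Q)
hookCondition-sound Q h x i j Mxj j≤x Mix i≤x =
  true≢false (trans (sym (cong₂ _∧_ x∈prₓQ⁻ x∈pr_yQ⁺)) (not-injective (allFin?-sound h x)))
  where
  x∈prₓQ⁻ : inPrX (minus Q) x ≡ true
  x∈prₓQ⁻ = anyFin-complete j (trans (mem-minus Q x j) (cong₂ _∧_ Mxj (≤F-complete j≤x)))
  x∈pr_yQ⁺ : inPrY (plus Q) x ≡ true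
  x∈pr_yQ⁺ = anyFin-complete i (trans (mem-plus Q i x) (cong₂ _∧_ Mix (≤F-complete i≤x)))

hookCondition-complete : (Q : Rel n) → Hooked (mem Q) → hookCondition Q ≡ true
hookCondition-complete {n} Q hooked = allFin?-complete no-hook
  where
  no-hook : ∀ x → not (inPrX (minus Q) x ∧ inPrY (plus Q) x) ≡ true
  no-hook x with inPrX (minus Q) x in x∈prₓQ⁻ | inPrY (plus Q) x in x∈pr_yQ⁺
  ... | false | _     = refl
  ... | true  | false = refl
  ... | true  | true  =
    let (j , Q⁻xj) = anyFin-sound x∈prₓQ⁻
        (i , Q⁺ix) = anyFin-sound x∈pr_yQ⁺
        Q⁻xj′ = trans (sym (mem-minus Q x j)) Q⁻xj
        Q⁺ix′ = trans (sym (mem-plus Q i x)) Q⁺ix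
    in ⊥-elim (hooked x i j (∧-conicalˡ _ _ Q⁻xj′) (≤F-sound (∧-conicalʳ _ _ Q⁻xj′))
                            (∧-conicalˡ _ _ Q⁺ix′) (≤F-sound (∧-conicalʳ _ _ Q⁺ix′)))

eqRel-sound : (Q R : Rel n) → eqRel Q R ≡ true → ∀ i j → mem Q i j ≡ mem R i j
eqRel-sound Q R h i j = ⌊⌋-sound (mem Q i j ≟ᴮ mem R i j) (allFin?-sound (allFin?-sound h i) j)

eqRel-complete : (Q R : Rel n) → (∀ i j → mem Q i j ≡ mem R i j) → eqRel Q R ≡ true
eqRel-complete Q R Q≗R = allFin?-complete λ i → allFin?-complete λ j → ⌊⌋-complete (_ ≟ᴮ _) (Q≗R i j)

eqPrY-sound : (Q R : Rel n) → eqPrY Q R ≡ true → ∀ y → occupiedCol (mem Q) y ≡ occupiedCol (mem R) y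
eqPrY-sound Q R h y = ⌊⌋-sound (_ ≟ᴮ _) (allFin?-sound h y)

eqPrY-complete : (Q R : Rel n) → (∀ y → occupiedCol (mem Q) y ≡ occupiedCol (mem R) y) → eqPrY Q R ≡ true
eqPrY-complete Q R Q≗R = allFin?-complete λ y → ⌊⌋-complete (_ ≟ᴮ _) (Q≗R y)

-- Partial permutations

insert-self : (i : Fin (suc n)) (j : Fin (suc n)) (π : Permutation′ n) → insert i j π ⟨$⟩ʳ i ≡ j
insert-self i j π with i ≟ᶠ i
... | yes _   = refl
... | no i≢i = ⊥-elim (i≢i refl)

-- Delete the row and column of some entry, extend the rest, and put the entry back with `insert`.
extend-to-permutation : (M : Mat n) → RowInjective M → ColInjective M →
                        Σ[ π ∈ Permutation′ n ] (∀ i j → M i j ≡ true → π ⟨$⟩ʳ i ≡ j)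
extend-to-permutation {zero}  M row-inj col-inj = idₚ , λ ()
extend-to-permutation {suc n} M row-inj col-inj with any? (λ i → any? (λ j → M i j ≟ᴮ true))
... | no ∄entry = idₚ , λ i j Mij → ⊥-elim (∄entry (i , j , Mij))
... | yes (i₀ , j₀ , Mi₀j₀) = insert i₀ j₀ π , embeds
  where
  M′ : Mat n
  M′ i j = M (punchIn i₀ i) (punchIn j₀ j)
  π,embeds′ = extend-to-permutation M′
    (λ i j j′ e e′ → punchIn-injective j₀ j j′ (row-inj _ _ _ e e′))
    (λ i i′ j e e′ → punchIn-injective i₀ i i′ (col-inj _ _ _ e e′))
  π = proj₁ π,embeds′
  embeds : ∀ i j → M i j ≡ true → insert i₀ j₀ π ⟨$⟩ʳ i ≡ j
  embeds i j Mij with i ≟ᶠ i₀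
  ... | yes refl = trans (insert-self i₀ j₀ π) (row-inj i₀ j₀ j Mi₀j₀ Mij)
  ... | no i≢i₀ = begin
    insert i₀ j₀ π ⟨$⟩ʳ i                  ≡⟨ cong (insert i₀ j₀ π ⟨$⟩ʳ_) (punchIn-punchOut i₀≢i) ⟨
    insert i₀ j₀ π ⟨$⟩ʳ punchIn i₀ i′      ≡⟨ insert-punchIn i₀ j₀ π i′ ⟩
    punchIn j₀ (π ⟨$⟩ʳ i′)                 ≡⟨ cong (punchIn j₀) (proj₂ π,embeds′ i′ j′ M′i′j′) ⟩
    punchIn j₀ j′                          ≡⟨ punchIn-punchOut j₀≢j ⟩
    j                                      ∎
    where
    open ≡-Reasoning
    i₀≢i : i₀ ≢ i
    i₀≢i = i≢i₀ ∘ sym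
    j₀≢j : j₀ ≢ j
    j₀≢j refl = i₀≢i (col-inj i₀ i j₀ Mi₀j₀ Mij)
    i′ = punchOut i₀≢i
    j′ = punchOut j₀≢j
    M′i′j′ : M′ i′ j′ ≡ true
    M′i′j′ = trans (cong₂ M (punchIn-punchOut i₀≢i) (punchIn-punchOut j₀≢j)) Mij

permutation-isPerm : (π : Permutation′ n) → isPerm (Vec.tabulate (π ⟨$⟩ʳ_)) ≡ true
permutation-isPerm {n} π = cong₂ _∧_ (allFin?-complete λ i → allFin?-complete (injective i)) (allFin?-complete surjective)
  where
  σ = Vec.tabulate (π ⟨$⟩ʳ_)
  injective : ∀ i j → (not (lookup σ i == lookup σ j) ∨ (i == j)) ≡ true
  injective i j rewrite lookup∘tabulate (π ⟨$⟩ʳ_) i | lookup∘tabulate (π ⟨$⟩ʳ_) j with i ≟ᶠ j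
  ... | yes refl = ∨-zeroʳ _
  ... | no i≢j   = trans (∨-identityʳ _) (cong not (⌊⌋-false (_ ≟ᶠ _) λ πi≡πj →
                     i≢j (trans (sym (inverseˡ π)) (trans (cong (π ⟨$⟩ˡ_) πi≡πj) (inverseˡ π)))))
  surjective : ∀ y → anyFin n (λ i → lookup σ i == y) ≡ true
  surjective y = anyFin-complete (π ⟨$⟩ˡ y)
    (trans (cong (_== y) (trans (lookup∘tabulate (π ⟨$⟩ʳ_) (π ⟨$⟩ˡ y)) (inverseʳ π))) (==-refl y))

isPerm-injective : {σ : Vec (Fin n) n} → isPerm σ ≡ true → ∀ i i′ → lookup σ i ≡ lookup σ i′ → i ≡ i′
isPerm-injective {σ = σ} h i i′ σi≡σi′ with allFin?-sound (allFin?-sound (∧-conicalˡ _ _ h) i) i′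
... | not-same∨same rewrite σi≡σi′ | ==-refl (lookup σ i′) = ⌊⌋-sound (i ≟ᶠ i′) not-same∨same

module _ (Q : Rel n) where

  private
    agrees : Vec (Fin n) n → Bool
    agrees σ = allFin? n (λ i → allFin? n (λ j → not (mem Q i j) ∨ (lookup σ i == j)))

  inSomePermDiagram-complete : RowInjective (mem Q) → ColInjective (mem Q) → inSomePermDiagram Q ≡ true
  inSomePermDiagram-complete row-inj col-inj =
    Equivalence.to T-≡ (any⁺ agrees (lose σ∈permutations (Equivalence.from T-≡ σ-agrees)))
    where
    π,embeds = extend-to-permutation (mem Q) row-inj col-inj
    σ = Vec.tabulate (proj₁ π,embeds ⟨$⟩ʳ_)
    σ∈permutations : σ ∈ permutations n
    σ∈permutations = ∈-filter⁺ (λ σ → T? (isPerm σ)) (∈-vecsOver ∈-allFin σ)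
                                (Equivalence.from T-≡ (permutation-isPerm (proj₁ π,embeds)))
    σ-agrees : agrees σ ≡ true
    σ-agrees = allFin?-complete λ i → allFin?-complete λ j → entry-agrees i j
      where
      entry-agrees : ∀ i j → (not (mem Q i j) ∨ (lookup σ i == j)) ≡ true
      entry-agrees i j with mem Q i j in Qij
      ... | false = refl
      ... | true  = trans (cong (_== j) (trans (lookup∘tabulate _ i) (proj₂ π,embeds i j Qij))) (==-refl j)

  inSomePermDiagram-sound : inSomePermDiagram Q ≡ true → RowInjective (mem Q) × ColInjective (mem Q)
  inSomePermDiagram-sound h = row-inj , col-inj
    where
    found = find (any⁻ agrees (permutations n) (Equivalence.from T-≡ h))
    σ = proj₁ found
    σ-isPerm : isPerm σ ≡ true
    σ-isPerm = Equivalence.to T-≡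
      (proj₂ (∈-filter⁻ (λ σ → T? (isPerm σ)) {xs = vecsOver (allFin n) n} (proj₁ (proj₂ found))))
    σ-embeds : ∀ i j → mem Q i j ≡ true → lookup σ i ≡ j
    σ-embeds i j Qij with allFin?-sound (allFin?-sound (Equivalence.to T-≡ (proj₂ (proj₂ found))) i) j
    ... | agrees-ij rewrite Qij = ⌊⌋-sound (_ ≟ᶠ j) agrees-ij
    row-inj : RowInjective (mem Q)
    row-inj i j j′ Qij Qij′ = trans (sym (σ-embeds i j Qij)) (σ-embeds i j′ Qij′)
    col-inj : ColInjective (mem Q)
    col-inj i i′ j Qij Qi′j = isPerm-injective {σ = σ} σ-isPerm i i′ (trans (σ-embeds i j Qij) (sym (σ-embeds i′ j Qi′j)))

-- Simply hooked quasi-permutations and good pairs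

record HookedPartialPermutation (M : Mat n) : Set where
  field
    row-injective : RowInjective M
    col-injective : ColInjective M
    hooked        : Hooked M

-- Size m ∸ k rather than n ∸ k: m is kept separate from the dimension n so that the
-- condition can be stated for the restriction of a matrix to its first n rows and columns.
record SimplyHooked (m k : ℕ) (M : Mat n) : Set where
  field
    hookedPP : HookedPartialPermutation M
    size     : entries M + k ≡ m

record GoodPair (m k i : ℕ) (M₁ M₂ : Mat n) : Set where
  field
    simplyHooked₁ : SimplyHooked m k M₁
    simplyHooked₂ : SimplyHooked m k M₂
    same-lower    : ∀ x y → lower M₁ x y ≡ lower M₂ x y
    lower-size₁   : entries (lower M₁) ≡ i
    lower-size₂   : entries (lower M₂) ≡ i
    same-columns  : ∀ y → occupiedCol M₁ y ≡ occupiedCol M₂ y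

-- `goodPair` of the statement, with its size test `card Q ≡ n ∸ k` replaced by an arbitrary one
isGoodPairBy : (ℕ → Bool) → ℕ → Rel n → Rel n → Bool
isGoodPairBy size i Q₁ Q₂ =
  isSimplyHookedBy Q₁ ∧ isSimplyHookedBy Q₂
  ∧ eqRel (minus Q₁) (minus Q₂)
  ∧ ⌊ card (minus Q₁) ≟ i ⌋ ∧ ⌊ card (minus Q₂) ≟ i ⌋
  ∧ eqPrY Q₁ Q₂
  where
  isSimplyHookedBy : Rel _ → Bool
  isSimplyHookedBy Q = inSomePermDiagram Q ∧ size (card Q) ∧ hookCondition Q

isGoodPairBy-cong : (size size′ : ℕ → Bool) (i : ℕ) → (∀ e → size e ≡ size′ e) →
                    (Q₁ Q₂ : Rel n) → isGoodPairBy size i Q₁ Q₂ ≡ isGoodPairBy size′ i Q₁ Q₂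
isGoodPairBy-cong size size′ i size≗size′ Q₁ Q₂ =
  cong₂ (λ x y → x ∧ y ∧ eqRel (minus Q₁) (minus Q₂)
                  ∧ ⌊ card (minus Q₁) ≟ i ⌋ ∧ ⌊ card (minus Q₂) ≟ i ⌋ ∧ eqPrY Q₁ Q₂)
        (cong (λ z → inSomePermDiagram Q₁ ∧ z ∧ hookCondition Q₁) (size≗size′ (card Q₁)))
        (cong (λ z → inSomePermDiagram Q₂ ∧ z ∧ hookCondition Q₂) (size≗size′ (card Q₂)))

isSimplyHooked : (m k : ℕ) → Rel n → Bool
isSimplyHooked m k Q = inSomePermDiagram Q ∧ ⌊ card Q + k ≟ m ⌋ ∧ hookCondition Q

isGoodPair : (m k i : ℕ) → Rel n → Rel n → Bool
isGoodPair m k = isGoodPairBy (λ e → ⌊ e + k ≟ m ⌋)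

card-minus : (Q : Rel n) → card (minus Q) ≡ entries (lower (mem Q))
card-minus Q = trans (card≡entries (minus Q)) (entries-cong (mem-minus Q))

module _ {m k : ℕ} (Q : Rel n) where

  isSimplyHooked-sound : isSimplyHooked m k Q ≡ true → SimplyHooked m k (mem Q)
  isSimplyHooked-sound h =
    let (perm , h′)   = ∧-split h
        (size , hook) = ∧-split h′
        (row-inj , col-inj) = inSomePermDiagram-sound Q perm
    in record { hookedPP = record { row-injective = row-inj ; col-injective = col-inj
                                  ; hooked = hookCondition-sound Q hook }
              ; size = trans (cong (_+ k) (sym (card≡entries Q))) (⌊⌋-sound (_ ≟ m) size) }

  isSimplyHooked-complete : SimplyHooked m k (mem Q) → isSimplyHooked m k Q ≡ true
  isSimplyHooked-complete sh = cong₂ _∧_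
    (inSomePermDiagram-complete Q row-injective col-injective)
    (cong₂ _∧_ (⌊⌋-complete (_ ≟ m) (trans (cong (_+ k) (card≡entries Q)) size)) (hookCondition-complete Q hooked))
    where open SimplyHooked sh; open HookedPartialPermutation hookedPP

module _ {m k i : ℕ} (Q₁ Q₂ : Rel n) where

  isGoodPair-sound : isGoodPair m k i Q₁ Q₂ ≡ true → GoodPair m k i (mem Q₁) (mem Q₂)
  isGoodPair-sound h =
    let (sh₁ , h₁)    = ∧-split h
        (sh₂ , h₂)    = ∧-split h₁
        (lower≡ , h₃) = ∧-split h₂
        (size₁ , h₄)  = ∧-split h₃
        (size₂ , pr)  = ∧-split h₄
    in record
      { simplyHooked₁ = isSimplyHooked-sound Q₁ sh₁
      ; simplyHooked₂ = isSimplyHooked-sound Q₂ sh₂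
      ; same-lower    = λ x y → trans (sym (mem-minus Q₁ x y))
                                  (trans (eqRel-sound (minus Q₁) (minus Q₂) lower≡ x y) (mem-minus Q₂ x y))
      ; lower-size₁   = trans (sym (card-minus Q₁)) (⌊⌋-sound (_ ≟ i) size₁)
      ; lower-size₂   = trans (sym (card-minus Q₂)) (⌊⌋-sound (_ ≟ i) size₂)
      ; same-columns  = eqPrY-sound Q₁ Q₂ pr
      }

  isGoodPair-complete : GoodPair m k i (mem Q₁) (mem Q₂) → isGoodPair m k i Q₁ Q₂ ≡ true
  isGoodPair-complete g =
    cong₂ _∧_ (isSimplyHooked-complete Q₁ simplyHooked₁) (cong₂ _∧_ (isSimplyHooked-complete Q₂ simplyHooked₂)
      (cong₂ _∧_ (eqRel-complete (minus Q₁) (minus Q₂) λ x y →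
                    trans (mem-minus Q₁ x y) (trans (same-lower x y) (sym (mem-minus Q₂ x y))))
      (cong₂ _∧_ (⌊⌋-complete (_ ≟ i) (trans (card-minus Q₁) lower-size₁))
      (cong₂ _∧_ (⌊⌋-complete (_ ≟ i) (trans (card-minus Q₂) lower-size₂))
                 (eqPrY-complete Q₁ Q₂ same-columns)))))
    where open GoodPair g

pairCount : (m n k i : ℕ) → ℕ
pairCount m n k i = ∑[ Q₁ ∈ allRels n ] ∑[ Q₂ ∈ allRels n ] 𝟙 (isGoodPair m k i Q₁ Q₂)

module _ {m k : ℕ} {M : Mat n} (sh : SimplyHooked m k M) where
  open SimplyHooked sh
  open HookedPartialPermutation hookedPP

  free-rows+size : count (freeRow M) + m ≡ n + k
  free-rows+size = count-not+size (occupiedRow M) (entries≡count-occupiedRow M row-injective) size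

  free-cols+size : count (freeCol M) + m ≡ n + k
  free-cols+size = count-not+size (occupiedCol M) (entries≡count-occupiedCol M col-injective) size

module _ {k : ℕ} {M : Mat n} (sh : SimplyHooked n k M) where

  count-freeRow : count (freeRow M) ≡ k
  count-freeRow = +-cancelʳ-≡ n _ k (trans (free-rows+size sh) (+-comm n k))

  count-freeCol : count (freeCol M) ≡ k
  count-freeCol = +-cancelʳ-≡ n _ k (trans (free-cols+size sh) (+-comm n k))

SimplyHooked-too-large : {M : Mat n} → SimplyHooked (suc n) 0 M → ⊥
SimplyHooked-too-large {n} {M} sh = m+1+n≢n (count (freeRow M)) (trans (free-rows+size sh) (+-identityʳ n))

isGoodPair⁻ : (m k i : ℕ) → Rel n → Rel n → Bool
isGoodPair⁻ m k zero    Q₁ Q₂ = false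
isGoodPair⁻ m k (suc i) Q₁ Q₂ = isGoodPair m k i Q₁ Q₂

isGoodPair⁻-sound : {m k : ℕ} (i : ℕ) (Q₁ Q₂ : Rel n) → isGoodPair⁻ m k i Q₁ Q₂ ≡ true →
                    Σ[ i′ ∈ ℕ ] i ≡ suc i′ × GoodPair m k i′ (mem Q₁) (mem Q₂)
isGoodPair⁻-sound (suc i) Q₁ Q₂ h = i , refl , isGoodPair-sound Q₁ Q₂ h

isGoodPair⁻-complete : {m k i′ : ℕ} (i : ℕ) (Q₁ Q₂ : Rel n) → i ≡ suc i′ →
                       GoodPair m k i′ (mem Q₁) (mem Q₂) → isGoodPair⁻ m k i Q₁ Q₂ ≡ true
isGoodPair⁻-complete (suc i) Q₁ Q₂ refl g = isGoodPair-complete Q₁ Q₂ g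

-- Adding a last row and column

Border : ℕ → Set
Border n = Vec Bool n × Vec Bool n × Bool

-- Q ⊞ (c , r , b) adds to Q a new last column c, a new last row r and the corner entry b.
_⊞_ : Rel n → Border n → Rel (suc n)
Q ⊞ (c , r , b) = zipWith _∷ʳ_ Q c ∷ʳ (r ∷ʳ b)

borders : (n : ℕ) → List (Border n)
borders n = cartesianProduct (boolVecs n) (cartesianProduct (boolVecs n) bits)

sumOver-borders : (f : Border n → ℕ) →
                  sumOver (borders n) f ≡ ∑[ c ∈ boolVecs n ] ∑[ r ∈ boolVecs n ] ∑[ b ∈ bits ] f (c , r , b)
sumOver-borders {n} f = trans (sumOver-cartesianProduct (boolVecs n) _ f)
  (sumOver-cong (boolVecs n) λ c → sumOver-cartesianProduct (boolVecs n) bits (λ rb → f (c , rb)))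

sumOver-allRels-suc : (f : Rel (suc n) → ℕ) →
                      sumOver (allRels (suc n)) f ≡ ∑[ Q ∈ allRels n ] ∑[ β ∈ borders n ] f (Q ⊞ β)
sumOver-allRels-suc {n} f = begin
  sumOver (allRels (suc n)) f
    ≡⟨ sumOver-vecsOver-∷ʳ (boolVecs (suc n)) n f ⟩
  ∑[ V ∈ vecsOver (boolVecs (suc n)) n ] ∑[ row ∈ boolVecs (suc n) ] f (V ∷ʳ row)
    ≡⟨ sumOver-cong (vecsOver (boolVecs (suc n)) n) (λ V → sumOver-vecsOver-∷ʳ bits n (λ row → f (V ∷ʳ row))) ⟩
  ∑[ V ∈ vecsOver (boolVecs (suc n)) n ] ∑[ r ∈ boolVecs n ] ∑[ b ∈ bits ] f (V ∷ʳ (r ∷ʳ b))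
    ≡⟨ sumOver-vecsOver-columns bits n n _ ⟩
  ∑[ Q ∈ allRels n ] ∑[ c ∈ boolVecs n ] ∑[ r ∈ boolVecs n ] ∑[ b ∈ bits ] f (Q ⊞ (c , r , b))
    ≡⟨ sumOver-cong (allRels n) (λ Q → sumOver-borders (λ β → f (Q ⊞ β))) ⟨
  ∑[ Q ∈ allRels n ] ∑[ β ∈ borders n ] f (Q ⊞ β) ∎
  where open ≡-Reasoning

borderWith : (Vec Bool n → Bool) → (Vec Bool n → Bool) → (Bool → Bool) → Border n → Bool
borderWith p q s (c , r , b) = p c ∧ q r ∧ s b

count-borderWith : (p q : Vec Bool n → Bool) (s : Bool → Bool) →
  ∑[ β ∈ borders n ] 𝟙 (borderWith p q s β)
    ≡ (∑[ c ∈ boolVecs n ] 𝟙 (p c)) * ((∑[ r ∈ boolVecs n ] 𝟙 (q r)) * (∑[ b ∈ bits ] 𝟙 (s b)))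
count-borderWith {n} p q s =
  trans (sumOver-cartesianProduct (boolVecs n) (cartesianProduct (boolVecs n) bits) (𝟙 ∘ borderWith p q s))
        (count-dependent-∧ (boolVecs n) (cartesianProduct (boolVecs n) bits) p (λ _ (r , b) → q r ∧ s b) λ _ →
          trans (sumOver-cartesianProduct (boolVecs n) bits (λ (r , b) → 𝟙 (q r ∧ s b)))
                (count-dependent-∧ (boolVecs n) bits q (λ _ → s) λ _ → refl))

emptyBorder : Border n → Bool
emptyBorder = borderWith isNull isNull not

newColumnEntry : Rel n → Border n → Bool
newColumnEntry Q = borderWith (isSingletonIn (freeRow (mem Q))) isNull not

newRowEntry : Rel n → Border n → Bool
newRowEntry Q = borderWith isNull (isSingletonIn (freeCol (mem Q))) not

sameRowAs : Border n → Border n → Bool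
sameRowAs (_ , r , _) = borderWith isNull (_==ᵛ r) not

count-emptyBorder : ∑[ β ∈ borders n ] 𝟙 (emptyBorder β) ≡ 1
count-emptyBorder {n} =
  trans (count-borderWith {n} isNull isNull not) (cong₂ (λ x y → x * (y * 1)) (count-isNull {n}) (count-isNull {n}))

count-newColumnEntry : (Q : Rel n) → ∑[ β ∈ borders n ] 𝟙 (newColumnEntry Q β) ≡ count (freeRow (mem Q))
count-newColumnEntry {n} Q = trans (count-borderWith (isSingletonIn (freeRow (mem Q))) isNull not)
  (trans (cong₂ (λ x y → x * (y * 1)) (count-isSingletonIn (freeRow (mem Q))) (count-isNull {n})) (*-identityʳ _))

count-newRowEntry : (Q : Rel n) → ∑[ β ∈ borders n ] 𝟙 (newRowEntry Q β) ≡ count (freeCol (mem Q))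
count-newRowEntry {n} Q = trans (count-borderWith isNull (isSingletonIn (freeCol (mem Q))) not)
  (trans (cong₂ (λ x y → x * (y * 1)) (count-isNull {n}) (count-isSingletonIn (freeCol (mem Q))))
         (trans (+-identityʳ _) (*-identityʳ _)))

count-sameRowAs : (β : Border n) → ∑[ β′ ∈ borders n ] 𝟙 (sameRowAs β β′) ≡ 1
count-sameRowAs {n} (c , r , b) =
  trans (count-borderWith isNull (_==ᵛ r) not) (cong₂ (λ x y → x * (y * 1)) (count-isNull {n}) (count-==ᵛ r))

borderSignature : Border n → Bool × Bool
borderSignature {n} (c , r , b) = anyFin n (lookup c) , anyFin n (lookup r)

emptyBorder-signature : (β : Border n) → emptyBorder β ≡ true → borderSignature β ≡ (false , false)
emptyBorder-signature (c , r , b) h =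
  cong₂ _,_ (isNull⇒anyFin-false c (∧-conicalˡ _ _ h))
            (isNull⇒anyFin-false r (∧-conicalˡ _ _ (∧-conicalʳ (isNull c) _ h)))

newColumnEntry-signature : (Q : Rel n) (β : Border n) → newColumnEntry Q β ≡ true → borderSignature β ≡ (true , false)
newColumnEntry-signature Q (c , r , b) h =
  cong₂ _,_ (isSingletonIn⇒anyFin _ c (∧-conicalˡ _ _ h))
            (isNull⇒anyFin-false r (∧-conicalˡ _ _ (∧-conicalʳ (isSingletonIn _ c) _ h)))

newRowEntry-signature : (Q : Rel n) (β : Border n) → newRowEntry Q β ≡ true → borderSignature β ≡ (false , true)
newRowEntry-signature Q (c , r , b) h =
  cong₂ _,_ (isNull⇒anyFin-false c (∧-conicalˡ _ _ h))
            (isSingletonIn⇒anyFin _ r (∧-conicalˡ _ _ (∧-conicalʳ (isNull c) _ h)))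

border-size : ∀ {d b} (e cc cr k : ℕ) → cc + cr ≡ d → b ≡ false → e + (cc + (cr + 𝟙 b)) + k ≡ d + (e + k)
border-size e cc cr k refl refl = solve 4 (λ e cc cr k → e :+ (cc :+ (cr :+ con 0)) :+ k := cc :+ cr :+ (e :+ k)) refl e cc cr k

lower-border-size : ∀ {d b} (e cr : ℕ) → cr ≡ d → b ≡ false → e + (cr + 𝟙 b) ≡ d + e
lower-border-size e cr refl refl = trans (cong (e +_) (+-identityʳ cr)) (+-comm e cr)

record Admissible (M : Mat n) (col row : Fin n → Bool) (b : Bool) : Set where
  field
    corner-empty    : b ≡ false
    col-unique      : ∀ a a′ → col a ≡ true → col a′ ≡ true → a ≡ a′
    row-unique      : ∀ j j′ → row j ≡ true → row j′ ≡ true → j ≡ j′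
    -- an entry in each would make the new index the row of a lower and the column of an upper entry
    col-row-exclusive : ∀ a j → col a ≡ true → row j ≡ true → ⊥
    col-at-free-row : ∀ a j → col a ≡ true → M a j ≡ true → ⊥
    row-at-free-col : ∀ j i → row j ≡ true → M i j ≡ true → ⊥

module Bordered (Q : Rel n) (c r : Vec Bool n) (b : Bool) where

  M N : Mat _
  M = mem Q
  N = mem (Q ⊞ (c , r , b))

  col row : Fin n → Bool
  col = lookup c
  row = lookup r

  private
    I : Fin n → Fin (suc n)
    I = inject₁
    L : Fin (suc n)
    L = fromℕ n

  N-old : ∀ i j → N (I i) (I j) ≡ M i j
  N-old i j rewrite lookup-∷ʳ-inject₁ (zipWith _∷ʳ_ Q c) (r ∷ʳ b) i | lookup-zipWith _∷ʳ_ i Q c =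
    lookup-∷ʳ-inject₁ (lookup Q i) (lookup c i) j

  N-col : ∀ i → N (I i) L ≡ col i
  N-col i rewrite lookup-∷ʳ-inject₁ (zipWith _∷ʳ_ Q c) (r ∷ʳ b) i | lookup-zipWith _∷ʳ_ i Q c =
    lookup-∷ʳ-fromℕ (lookup Q i) (lookup c i)

  N-row : ∀ j → N L (I j) ≡ row j
  N-row j rewrite lookup-∷ʳ-fromℕ (zipWith _∷ʳ_ Q c) (r ∷ʳ b) = lookup-∷ʳ-inject₁ r b j

  N-corner : N L L ≡ b
  N-corner rewrite lookup-∷ʳ-fromℕ (zipWith _∷ʳ_ Q c) (r ∷ʳ b) = lookup-∷ʳ-fromℕ r b

  entries-N : entries N ≡ entries M + (count col + (count row + 𝟙 b))
  entries-N = trans (entries-last N)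
    (cong₂ _+_ (entries-cong N-old)
      (cong₂ _+_ (sum-cong-≗ (cong 𝟙 ∘ N-col)) (cong₂ _+_ (sum-cong-≗ (cong 𝟙 ∘ N-row)) (cong 𝟙 N-corner))))

  lower-N-old : ∀ x y → lower N (I x) (I y) ≡ lower M x y
  lower-N-old x y rewrite N-old x y | toℕ-inject₁ x | toℕ-inject₁ y = refl

  lower-N-col : ∀ x → lower N (I x) L ≡ false
  lower-N-col x = trans (cong (N (I x) L ∧_) (¬-not (fromℕ≰inject₁ x ∘ ≤F-sound))) (∧-zeroʳ _)

  lower-N-row : ∀ y → lower N L (I y) ≡ row y
  lower-N-row y = trans (cong₂ _∧_ (N-row y) (≤F-complete (≤fromℕ (I y)))) (∧-identityʳ _)

  lower-N-corner : lower N L L ≡ b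
  lower-N-corner = trans (cong₂ _∧_ N-corner (≤F-complete (≤fromℕ L))) (∧-identityʳ _)

  entries-lower-N : entries (lower N) ≡ entries (lower M) + (count row + 𝟙 b)
  entries-lower-N = trans (entries-last (lower N))
    (cong₂ _+_ (entries-cong lower-N-old)
      (cong₂ _+_ (count-none lower-N-col) (cong₂ _+_ (sum-cong-≗ (cong 𝟙 ∘ lower-N-row)) (cong 𝟙 lower-N-corner))))

  entries-N-with : ∀ {d} (k : ℕ) → count col + count row ≡ d → b ≡ false →
                   entries M + (count col + (count row + 𝟙 b)) + k ≡ d + (entries M + k)
  entries-N-with k = border-size (entries M) (count col) (count row) k

  entries-lower-N-with : ∀ {d} → count row ≡ d → b ≡ false → entries (lower M) + (count row + 𝟙 b) ≡ d + entries (lower M)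
  entries-lower-N-with = lower-border-size (entries (lower M)) (count row)

  occupiedCol-N-old : ∀ y → occupiedCol N (I y) ≡ (occupiedCol M y ∨ row y)
  occupiedCol-N-old y = ≡true-ext to from
    where
    to : occupiedCol N (I y) ≡ true → (occupiedCol M y ∨ row y) ≡ true
    to occupied with anyFin-sound {p = λ x → N x (I y)} occupied
    ... | x , Nxy with view x
    ...   | ‵fromℕ     = trans (cong (occupiedCol M y ∨_) (trans (sym (N-row y)) Nxy)) (∨-zeroʳ _)
    ...   | ‵inject₁ i = cong (_∨ row y) (anyFin-complete i (trans (sym (N-old i y)) Nxy))
    from : (occupiedCol M y ∨ row y) ≡ true → occupiedCol N (I y) ≡ true
    from h with occupiedCol M y in occupied
    ... | true  = let (i , Miy) = anyFin-sound {p = λ x → M x y} occupied in anyFin-complete (I i) (trans (N-old i y) Miy)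
    ... | false = anyFin-complete L (trans (N-row y) h)

  occupiedCol-N-new : occupiedCol N L ≡ (anyFin n col ∨ b)
  occupiedCol-N-new = ≡true-ext to from
    where
    to : occupiedCol N L ≡ true → (anyFin n col ∨ b) ≡ true
    to occupied with anyFin-sound {p = λ x → N x L} occupied
    ... | x , NxL with view x
    ...   | ‵fromℕ     = trans (cong (anyFin n col ∨_) (trans (sym N-corner) NxL)) (∨-zeroʳ _)
    ...   | ‵inject₁ i = cong (_∨ b) (anyFin-complete i (trans (sym (N-col i)) NxL))
    from : (anyFin n col ∨ b) ≡ true → occupiedCol N L ≡ true
    from h with anyFin n col in occupied
    ... | true  = let (i , coli) = anyFin-sound {p = col} occupied in anyFin-complete (I i) (trans (N-col i) coli)
    ... | false = anyFin-complete L (trans N-corner h)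

  bordered-sound : HookedPartialPermutation N → HookedPartialPermutation M × Admissible M col row b
  bordered-sound hpp = record
    { row-injective = λ i j j′ e e′ → inject₁-injective (row-injective (I i) (I j) (I j′) (N-old′ e) (N-old′ e′))
    ; col-injective = λ i i′ j e e′ → inject₁-injective (col-injective (I i) (I i′) (I j) (N-old′ e) (N-old′ e′))
    ; hooked = λ x i j Mxj j≤x Mix i≤x →
        hooked (I x) (I i) (I j) (N-old′ Mxj) (inject₁-mono j≤x) (N-old′ Mix) (inject₁-mono i≤x)
    } , record
    { corner-empty = ¬-not λ b≡true → let NLL = trans N-corner b≡true in
        hooked L L L NLL (≤fromℕ L) NLL (≤fromℕ L)
    ; col-unique = λ a a′ e e′ → inject₁-injective (col-injective (I a) (I a′) L (N-col′ e) (N-col′ e′))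
    ; row-unique = λ j j′ e e′ → inject₁-injective (row-injective L (I j) (I j′) (N-row′ e) (N-row′ e′))
    ; col-row-exclusive = λ a j e e′ → hooked L (I a) (I j) (N-row′ e′) (≤fromℕ (I j)) (N-col′ e) (≤fromℕ (I a))
    ; col-at-free-row = λ a j e e′ → fromℕ≢inject₁ (row-injective (I a) L (I j) (N-col′ e) (N-old′ e′))
    ; row-at-free-col = λ j i e e′ → fromℕ≢inject₁ (col-injective L (I i) (I j) (N-row′ e) (N-old′ e′))
    }
    where
    open HookedPartialPermutation hpp
    N-old′ : ∀ {i j} → M i j ≡ true → N (I i) (I j) ≡ true
    N-old′ {i} {j} = trans (N-old i j)
    N-col′ : ∀ {i} → col i ≡ true → N (I i) L ≡ true
    N-col′ {i} = trans (N-col i)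
    N-row′ : ∀ {j} → row j ≡ true → N L (I j) ≡ true
    N-row′ {j} = trans (N-row j)
    inject₁-mono : ∀ {x y} → x ≤ᶠ y → I x ≤ᶠ I y
    inject₁-mono {x} {y} = subst₂ _≤_ (sym (toℕ-inject₁ x)) (sym (toℕ-inject₁ y))

  bordered-complete : HookedPartialPermutation M → Admissible M col row b → HookedPartialPermutation N
  bordered-complete hpp adm = record { row-injective = row-inj ; col-injective = col-inj ; hooked = hook }
    where
    open HookedPartialPermutation hpp
    open Admissible adm
    M′ : ∀ {i j} → N (I i) (I j) ≡ true → M i j ≡ true
    M′ {i} {j} = trans (sym (N-old i j))
    col′ : ∀ {i} → N (I i) L ≡ true → col i ≡ true
    col′ {i} = trans (sym (N-col i))
    row′ : ∀ {j} → N L (I j) ≡ true → row j ≡ true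
    row′ {j} = trans (sym (N-row j))
    no-corner : N L L ≡ true → ⊥
    no-corner e = true≢false (trans (sym e) (trans N-corner corner-empty))
    row-inj : RowInjective N
    row-inj x j j′ e e′ with view x | view j | view j′
    ... | ‵fromℕ     | ‵fromℕ     | _          = ⊥-elim (no-corner e)
    ... | ‵fromℕ     | _          | ‵fromℕ     = ⊥-elim (no-corner e′)
    ... | ‵fromℕ     | ‵inject₁ y | ‵inject₁ y′ = cong I (row-unique y y′ (row′ e) (row′ e′))
    ... | ‵inject₁ i | ‵fromℕ     | ‵fromℕ     = refl
    ... | ‵inject₁ i | ‵fromℕ     | ‵inject₁ y′ = ⊥-elim (col-at-free-row i y′ (col′ e) (M′ e′))
    ... | ‵inject₁ i | ‵inject₁ y | ‵fromℕ     = ⊥-elim (col-at-free-row i y (col′ e′) (M′ e))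
    ... | ‵inject₁ i | ‵inject₁ y | ‵inject₁ y′ = cong I (row-injective i y y′ (M′ e) (M′ e′))
    col-inj : ColInjective N
    col-inj x x′ j e e′ with view j | view x | view x′
    ... | ‵fromℕ     | ‵fromℕ     | _          = ⊥-elim (no-corner e)
    ... | ‵fromℕ     | _          | ‵fromℕ     = ⊥-elim (no-corner e′)
    ... | ‵fromℕ     | ‵inject₁ i | ‵inject₁ i′ = cong I (col-unique i i′ (col′ e) (col′ e′))
    ... | ‵inject₁ y | ‵fromℕ     | ‵fromℕ     = refl
    ... | ‵inject₁ y | ‵fromℕ     | ‵inject₁ i′ = ⊥-elim (row-at-free-col y i′ (row′ e) (M′ e′))
    ... | ‵inject₁ y | ‵inject₁ i | ‵fromℕ     = ⊥-elim (row-at-free-col y i (row′ e′) (M′ e))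
    ... | ‵inject₁ y | ‵inject₁ i | ‵inject₁ i′ = cong I (col-injective i i′ y (M′ e) (M′ e′))
    hook : Hooked N
    hook x i j Nxj j≤x Nix i≤x with view x | view i | view j
    ... | ‵fromℕ      | ‵fromℕ     | _          = no-corner Nix
    ... | ‵fromℕ      | _          | ‵fromℕ     = no-corner Nxj
    ... | ‵fromℕ      | ‵inject₁ a | ‵inject₁ y = col-row-exclusive a y (col′ Nix) (row′ Nxj)
    ... | ‵inject₁ x′ | ‵fromℕ     | _          = fromℕ≰inject₁ x′ i≤x
    ... | ‵inject₁ x′ | _          | ‵fromℕ     = fromℕ≰inject₁ x′ j≤x
    ... | ‵inject₁ x′ | ‵inject₁ a | ‵inject₁ y =
      hooked x′ a y (M′ Nxj) (inject₁-reflects j≤x) (M′ Nix) (inject₁-reflects i≤x)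
      where
      inject₁-reflects : ∀ {u v} → I u ≤ᶠ I v → u ≤ᶠ v
      inject₁-reflects {u} {v} = subst₂ _≤_ (toℕ-inject₁ u) (toℕ-inject₁ v)

  private
    ≡false⇒≢true : ∀ {x} → x ≡ false → x ≡ true → ⊥
    ≡false⇒≢true x≡false x≡true = true≢false (trans (sym x≡true) x≡false)

  emptyBorder-admissible : emptyBorder (c , r , b) ≡ true →
                           Admissible M col row b × count col ≡ 0 × count row ≡ 0
  emptyBorder-admissible h =
    let (c-null , h′) = ∧-split h
        (r-null , nb) = ∧-split h′
        col-null = isNull-sound c c-null
        row-null = isNull-sound r r-null
    in record
      { corner-empty      = not-injective nb
      ; col-unique        = λ a _ e _ → ⊥-elim (≡false⇒≢true (col-null a) e)
      ; row-unique        = λ j _ e _ → ⊥-elim (≡false⇒≢true (row-null j) e)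
      ; col-row-exclusive = λ a _ e _ → ≡false⇒≢true (col-null a) e
      ; col-at-free-row   = λ a _ e _ → ≡false⇒≢true (col-null a) e
      ; row-at-free-col   = λ j _ e _ → ≡false⇒≢true (row-null j) e
      } , count-none col-null , count-none row-null

  newColumnEntry-admissible : newColumnEntry Q (c , r , b) ≡ true →
                              Admissible M col row b × count col ≡ 1 × count row ≡ 0
  newColumnEntry-admissible h =
    let (c-single , h′) = ∧-split h
        (r-null , nb)   = ∧-split h′
        (a , free-a , col-a , only-a) = isSingletonIn-sound (freeRow M) c c-single
        row-null = isNull-sound r r-null
    in record
      { corner-empty      = not-injective nb
      ; col-unique        = λ x x′ e e′ → trans (only-a x e) (sym (only-a x′ e′))
      ; row-unique        = λ j _ e _ → ⊥-elim (≡false⇒≢true (row-null j) e)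
      ; col-row-exclusive = λ _ j _ e → ≡false⇒≢true (row-null j) e
      ; col-at-free-row   = λ x j e Mxj → freeRow-sound {M = M} free-a j (subst (λ z → M z j ≡ true) (only-a x e) Mxj)
      ; row-at-free-col   = λ j _ e _ → ≡false⇒≢true (row-null j) e
      } , count-unique a col-a only-a , count-none row-null

  newRowEntry-admissible : newRowEntry Q (c , r , b) ≡ true →
                           Admissible M col row b × count col ≡ 0 × count row ≡ 1
  newRowEntry-admissible h =
    let (c-null , h′)   = ∧-split h
        (r-single , nb) = ∧-split h′
        (j , free-j , row-j , only-j) = isSingletonIn-sound (freeCol M) r r-single
        col-null = isNull-sound c c-null
    in record
      { corner-empty      = not-injective nb
      ; col-unique        = λ a _ e _ → ⊥-elim (≡false⇒≢true (col-null a) e)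
      ; row-unique        = λ y y′ e e′ → trans (only-j y e) (sym (only-j y′ e′))
      ; col-row-exclusive = λ a _ e _ → ≡false⇒≢true (col-null a) e
      ; col-at-free-row   = λ a _ e _ → ≡false⇒≢true (col-null a) e
      ; row-at-free-col   = λ y i e Miy → freeCol-sound {M = M} free-j i (subst (λ z → M i z ≡ true) (only-j y e) Miy)
      } , count-none col-null , count-unique j row-j only-j

  admissible-trichotomy : Admissible M col row b →
    emptyBorder (c , r , b) ≡ true ⊎ newColumnEntry Q (c , r , b) ≡ true ⊎ newRowEntry Q (c , r , b) ≡ true
  admissible-trichotomy adm = shape (any? (λ a → col a ≟ᴮ true)) (any? (λ j → row j ≟ᴮ true))
    where
    open Admissible adm
    null : (v : Vec Bool n) → ((∃ λ x → lookup v x ≡ true) → ⊥) → isNull v ≡ true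
    null v ∄entry = isNull-complete v λ x → ¬-not λ vx → ∄entry (x , vx)
    shape : Dec (∃ λ a → col a ≡ true) → Dec (∃ λ j → row j ≡ true) →
      emptyBorder (c , r , b) ≡ true ⊎ newColumnEntry Q (c , r , b) ≡ true ⊎ newRowEntry Q (c , r , b) ≡ true
    shape (yes (a , col-a)) (yes (j , row-j)) = ⊥-elim (col-row-exclusive a j col-a row-j)
    shape (yes (a , col-a)) (no ∄row) = inj₂ (inj₁ (cong₂ _∧_
      (isSingletonIn-complete (freeRow M) c
        (a , freeRow-complete {M = M} (λ j → col-at-free-row a j col-a) , col-a , λ x e → col-unique x a e col-a))
      (cong₂ _∧_ (null r ∄row) (cong not corner-empty))))
    shape (no ∄col) (yes (j , row-j)) = inj₂ (inj₂ (cong₂ _∧_ (null c ∄col) (cong₂ _∧_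
      (isSingletonIn-complete (freeCol M) r
        (j , freeCol-complete {M = M} (λ i → row-at-free-col j i row-j) , row-j , λ y e → row-unique y j e row-j))
      (cong not corner-empty))))
    shape (no ∄col) (no ∄row) = inj₁ (cong₂ _∧_ (null c ∄col) (cong₂ _∧_ (null r ∄row) (cong not corner-empty)))

module BorderedPair (k i : ℕ) (Q₁ Q₂ : Rel n) (c₁ r₁ : Vec Bool n) (b₁ : Bool) (c₂ r₂ : Vec Bool n) (b₂ : Bool) where

  module B₁ = Bordered Q₁ c₁ r₁ b₁
  module B₂ = Bordered Q₂ c₂ r₂ b₂
  open B₁ using () renaming (M to M₁; N to N₁; col to col₁; row to row₁)
  open B₂ using () renaming (M to M₂; N to N₂; col to col₂; row to row₂)

  record GoodParts : Set where
    field
      hookedPP₁       : HookedPartialPermutation M₁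
      hookedPP₂       : HookedPartialPermutation M₂
      admissible₁     : Admissible M₁ col₁ row₁ b₁
      admissible₂     : Admissible M₂ col₂ row₂ b₂
      size₁           : entries M₁ + (count col₁ + (count row₁ + 𝟙 b₁)) + k ≡ suc n
      size₂           : entries M₂ + (count col₂ + (count row₂ + 𝟙 b₂)) + k ≡ suc n
      same-lower      : ∀ x y → lower M₁ x y ≡ lower M₂ x y
      same-row        : ∀ y → row₁ y ≡ row₂ y
      lower-size₁     : entries (lower M₁) + (count row₁ + 𝟙 b₁) ≡ i
      lower-size₂     : entries (lower M₂) + (count row₂ + 𝟙 b₂) ≡ i
      same-columns    : ∀ y → (occupiedCol M₁ y ∨ row₁ y) ≡ (occupiedCol M₂ y ∨ row₂ y)
      same-new-column : (anyFin n col₁ ∨ b₁) ≡ (anyFin n col₂ ∨ b₂)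

  goodParts-sound : GoodPair (suc n) k i N₁ N₂ → GoodParts
  goodParts-sound g = record
    { hookedPP₁       = proj₁ side₁
    ; hookedPP₂       = proj₁ side₂
    ; admissible₁     = proj₂ side₁
    ; admissible₂     = proj₂ side₂
    ; size₁           = trans (cong (_+ k) (sym B₁.entries-N)) (SimplyHooked.size simplyHooked₁)
    ; size₂           = trans (cong (_+ k) (sym B₂.entries-N)) (SimplyHooked.size simplyHooked₂)
    ; same-lower      = λ x y → trans (sym (B₁.lower-N-old x y))
                                        (trans (same-lower (inject₁ x) (inject₁ y)) (B₂.lower-N-old x y))
    ; same-row        = λ y → trans (sym (B₁.lower-N-row y)) (trans (same-lower (fromℕ n) (inject₁ y)) (B₂.lower-N-row y))
    ; lower-size₁     = trans (sym B₁.entries-lower-N) lower-size₁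
    ; lower-size₂     = trans (sym B₂.entries-lower-N) lower-size₂
    ; same-columns    = λ y → trans (sym (B₁.occupiedCol-N-old y)) (trans (same-columns (inject₁ y)) (B₂.occupiedCol-N-old y))
    ; same-new-column = trans (sym B₁.occupiedCol-N-new) (trans (same-columns (fromℕ n)) B₂.occupiedCol-N-new)
    }
    where
    open GoodPair g
    side₁ = B₁.bordered-sound (SimplyHooked.hookedPP simplyHooked₁)
    side₂ = B₂.bordered-sound (SimplyHooked.hookedPP simplyHooked₂)

  goodParts-complete : GoodParts → GoodPair (suc n) k i N₁ N₂
  goodParts-complete p = record
    { simplyHooked₁ = record { hookedPP = B₁.bordered-complete hookedPP₁ admissible₁
                             ; size = trans (cong (_+ k) B₁.entries-N) size₁ }
    ; simplyHooked₂ = record { hookedPP = B₂.bordered-complete hookedPP₂ admissible₂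
                             ; size = trans (cong (_+ k) B₂.entries-N) size₂ }
    ; same-lower    = lower≗
    ; lower-size₁   = trans B₁.entries-lower-N lower-size₁
    ; lower-size₂   = trans B₂.entries-lower-N lower-size₂
    ; same-columns  = columns≗
    }
    where
    open GoodParts p
    lower≗ : ∀ x y → lower N₁ x y ≡ lower N₂ x y
    lower≗ x y with view x | view y
    ... | ‵fromℕ      | ‵fromℕ      = trans B₁.lower-N-corner (trans (Admissible.corner-empty admissible₁)
                                        (sym (trans B₂.lower-N-corner (Admissible.corner-empty admissible₂))))
    ... | ‵fromℕ      | ‵inject₁ y′ = trans (B₁.lower-N-row y′) (trans (same-row y′) (sym (B₂.lower-N-row y′)))
    ... | ‵inject₁ x′ | ‵fromℕ      = trans (B₁.lower-N-col x′) (sym (B₂.lower-N-col x′))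
    ... | ‵inject₁ x′ | ‵inject₁ y′ =
      trans (B₁.lower-N-old x′ y′) (trans (same-lower x′ y′) (sym (B₂.lower-N-old x′ y′)))
    columns≗ : ∀ y → occupiedCol N₁ y ≡ occupiedCol N₂ y
    columns≗ y with view y
    ... | ‵fromℕ      = trans B₁.occupiedCol-N-new (trans same-new-column (sym B₂.occupiedCol-N-new))
    ... | ‵inject₁ y′ = trans (B₁.occupiedCol-N-old y′) (trans (same-columns y′) (sym (B₂.occupiedCol-N-old y′)))

  β₁ β₂ : Border n
  β₁ = c₁ , r₁ , b₁
  β₂ = c₂ , r₂ , b₂

  bothEmpty bothNewColumn sharedNewRow : Bool
  bothEmpty     = emptyBorder β₁ ∧ emptyBorder β₂ ∧ isGoodPair (suc n) k i Q₁ Q₂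
  bothNewColumn = newColumnEntry Q₁ β₁ ∧ newColumnEntry Q₂ β₂ ∧ isGoodPair n k i Q₁ Q₂
  sharedNewRow  = newRowEntry Q₁ β₁ ∧ sameRowAs β₁ β₂ ∧ isGoodPair⁻ n k i Q₁ Q₂

  bothEmpty-goodParts : emptyBorder β₁ ≡ true → emptyBorder β₂ ≡ true →
                        isGoodPair (suc n) k i Q₁ Q₂ ≡ true → GoodParts
  bothEmpty-goodParts e₁ e₂ good = record
    { hookedPP₁       = SimplyHooked.hookedPP simplyHooked₁
    ; hookedPP₂       = SimplyHooked.hookedPP simplyHooked₂
    ; admissible₁     = adm₁
    ; admissible₂     = adm₂
    ; size₁           = trans (B₁.entries-N-with k (cong₂ _+_ no-col₁ no-row₁) (corner-empty adm₁))
                              (SimplyHooked.size simplyHooked₁)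
    ; size₂           = trans (B₂.entries-N-with k (cong₂ _+_ no-col₂ no-row₂) (corner-empty adm₂))
                              (SimplyHooked.size simplyHooked₂)
    ; same-lower      = same-lower
    ; same-row        = same-row
    ; lower-size₁     = trans (B₁.entries-lower-N-with no-row₁ (corner-empty adm₁)) lower-size₁
    ; lower-size₂     = trans (B₂.entries-lower-N-with no-row₂ (corner-empty adm₂)) lower-size₂
    ; same-columns    = λ y → cong₂ _∨_ (same-columns y) (same-row y)
    ; same-new-column = cong₂ _∨_ (trans (anyFin-false (count≡0⇒none col₁ no-col₁))
                                         (sym (anyFin-false (count≡0⇒none col₂ no-col₂))))
                                  (trans (corner-empty adm₁) (sym (corner-empty adm₂)))
    }
    where
    open GoodPair (isGoodPair-sound Q₁ Q₂ good)
    open Admissible using (corner-empty)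
    adm₁ = proj₁ (B₁.emptyBorder-admissible e₁)
    adm₂ = proj₁ (B₂.emptyBorder-admissible e₂)
    no-col₁ = proj₁ (proj₂ (B₁.emptyBorder-admissible e₁))
    no-row₁ = proj₂ (proj₂ (B₁.emptyBorder-admissible e₁))
    no-col₂ = proj₁ (proj₂ (B₂.emptyBorder-admissible e₂))
    no-row₂ = proj₂ (proj₂ (B₂.emptyBorder-admissible e₂))
    same-row : ∀ y → row₁ y ≡ row₂ y
    same-row y = trans (count≡0⇒none row₁ no-row₁ y) (sym (count≡0⇒none row₂ no-row₂ y))

  bothNewColumn-goodParts : newColumnEntry Q₁ β₁ ≡ true → newColumnEntry Q₂ β₂ ≡ true →
                            isGoodPair n k i Q₁ Q₂ ≡ true → GoodParts
  bothNewColumn-goodParts nc₁ nc₂ good = record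
    { hookedPP₁       = SimplyHooked.hookedPP simplyHooked₁
    ; hookedPP₂       = SimplyHooked.hookedPP simplyHooked₂
    ; admissible₁     = adm₁
    ; admissible₂     = adm₂
    ; size₁           = trans (B₁.entries-N-with k (cong₂ _+_ one-col₁ no-row₁) (corner-empty adm₁))
                              (cong suc (SimplyHooked.size simplyHooked₁))
    ; size₂           = trans (B₂.entries-N-with k (cong₂ _+_ one-col₂ no-row₂) (corner-empty adm₂))
                              (cong suc (SimplyHooked.size simplyHooked₂))
    ; same-lower      = same-lower
    ; same-row        = same-row
    ; lower-size₁     = trans (B₁.entries-lower-N-with no-row₁ (corner-empty adm₁)) lower-size₁
    ; lower-size₂     = trans (B₂.entries-lower-N-with no-row₂ (corner-empty adm₂)) lower-size₂
    ; same-columns    = λ y → cong₂ _∨_ (same-columns y) (same-row y)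
    ; same-new-column = cong₂ _∨_ (trans (isSingletonIn⇒anyFin _ c₁ (∧-conicalˡ _ _ nc₁))
                                         (sym (isSingletonIn⇒anyFin _ c₂ (∧-conicalˡ _ _ nc₂))))
                                  (trans (corner-empty adm₁) (sym (corner-empty adm₂)))
    }
    where
    open GoodPair (isGoodPair-sound Q₁ Q₂ good)
    open Admissible using (corner-empty)
    adm₁ = proj₁ (B₁.newColumnEntry-admissible nc₁)
    adm₂ = proj₁ (B₂.newColumnEntry-admissible nc₂)
    one-col₁ = proj₁ (proj₂ (B₁.newColumnEntry-admissible nc₁))
    no-row₁  = proj₂ (proj₂ (B₁.newColumnEntry-admissible nc₁))
    one-col₂ = proj₁ (proj₂ (B₂.newColumnEntry-admissible nc₂))
    no-row₂  = proj₂ (proj₂ (B₂.newColumnEntry-admissible nc₂))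
    same-row : ∀ y → row₁ y ≡ row₂ y
    same-row y = trans (count≡0⇒none row₁ no-row₁ y) (sym (count≡0⇒none row₂ no-row₂ y))

  sameRowAs-row : sameRowAs β₁ β₂ ≡ true → r₂ ≡ r₁
  sameRowAs-row same = ==ᵛ-sound r₂ r₁ (∧-conicalˡ _ _ (∧-conicalʳ (isNull c₂) _ same))

  newRowEntry-sameRowAs : newRowEntry Q₁ β₁ ≡ true → sameRowAs β₁ β₂ ≡ true →
                          (∀ y → occupiedCol M₁ y ≡ occupiedCol M₂ y) → newRowEntry Q₂ β₂ ≡ true
  newRowEntry-sameRowAs nr₁ same same-columns = cong₂ _∧_ (∧-conicalˡ (isNull c₂) _ same)
    (cong₂ _∧_ (subst (λ v → isSingletonIn (freeCol M₂) v ≡ true) (sym (sameRowAs-row same)) single₂)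
               (∧-conicalʳ (r₂ ==ᵛ r₁) (not b₂) (∧-conicalʳ (isNull c₂) _ same)))
    where
    single₁ = isSingletonIn-sound (freeCol M₁) r₁ (∧-conicalˡ _ _ (∧-conicalʳ (isNull c₁) _ nr₁))
    j = proj₁ single₁
    single₂ : isSingletonIn (freeCol M₂) r₁ ≡ true
    single₂ = isSingletonIn-complete (freeCol M₂) r₁
      (j , trans (cong not (sym (same-columns j))) (proj₁ (proj₂ single₁)) , proj₂ (proj₂ single₁))

  sharedNewRow-goodParts : newRowEntry Q₁ β₁ ≡ true → sameRowAs β₁ β₂ ≡ true →
                           isGoodPair⁻ n k i Q₁ Q₂ ≡ true → GoodParts
  sharedNewRow-goodParts nr₁ same good⁻ = record
    { hookedPP₁       = SimplyHooked.hookedPP simplyHooked₁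
    ; hookedPP₂       = SimplyHooked.hookedPP simplyHooked₂
    ; admissible₁     = adm₁
    ; admissible₂     = adm₂
    ; size₁           = trans (B₁.entries-N-with k (cong₂ _+_ no-col₁ one-row₁) (corner-empty adm₁))
                              (cong suc (SimplyHooked.size simplyHooked₁))
    ; size₂           = trans (B₂.entries-N-with k (cong₂ _+_ no-col₂ one-row₂) (corner-empty adm₂))
                              (cong suc (SimplyHooked.size simplyHooked₂))
    ; same-lower      = same-lower
    ; same-row        = same-row
    ; lower-size₁     = trans (B₁.entries-lower-N-with one-row₁ (corner-empty adm₁))
                              (trans (cong suc lower-size₁) (sym i≡suc-i′))
    ; lower-size₂     = trans (B₂.entries-lower-N-with one-row₂ (corner-empty adm₂))
                              (trans (cong suc lower-size₂) (sym i≡suc-i′))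
    ; same-columns    = λ y → cong₂ _∨_ (same-columns y) (same-row y)
    ; same-new-column = cong₂ _∨_ (trans (isNull⇒anyFin-false c₁ (∧-conicalˡ _ _ nr₁))
                                         (sym (isNull⇒anyFin-false c₂ (∧-conicalˡ (isNull c₂) _ same))))
                                  (trans (corner-empty adm₁) (sym (corner-empty adm₂)))
    }
    where
    open Admissible using (corner-empty)
    i′,good = isGoodPair⁻-sound i Q₁ Q₂ good⁻
    i≡suc-i′ = proj₁ (proj₂ i′,good)
    open GoodPair (proj₂ (proj₂ i′,good))
    same-row : ∀ y → row₁ y ≡ row₂ y
    same-row y = cong (λ v → lookup v y) (sym (sameRowAs-row same))
    nr₂ : newRowEntry Q₂ β₂ ≡ true
    nr₂ = newRowEntry-sameRowAs nr₁ same same-columns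
    adm₁ = proj₁ (B₁.newRowEntry-admissible nr₁)
    adm₂ = proj₁ (B₂.newRowEntry-admissible nr₂)
    no-col₁  = proj₁ (proj₂ (B₁.newRowEntry-admissible nr₁))
    one-row₁ = proj₂ (proj₂ (B₁.newRowEntry-admissible nr₁))
    no-col₂  = proj₁ (proj₂ (B₂.newRowEntry-admissible nr₂))
    one-row₂ = proj₂ (proj₂ (B₂.newRowEntry-admissible nr₂))

  signatures-agree : GoodParts → borderSignature β₁ ≡ borderSignature β₂
  signatures-agree p = cong₂ _,_
    (∨-cancelʳ-false (Admissible.corner-empty admissible₁) (Admissible.corner-empty admissible₂) same-new-column)
    (cong (λ v → anyFin n (lookup v)) (lookup-ext r₁ r₂ same-row))
    where open GoodParts p

  shapes-mismatch : GoodParts → ∀ {s₁ s₂} →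
                    borderSignature β₁ ≡ s₁ → borderSignature β₂ ≡ s₂ → s₁ ≢ s₂ → ⊥
  shapes-mismatch p sig₁ sig₂ s₁≢s₂ = s₁≢s₂ (trans (sym sig₁) (trans (signatures-agree p) sig₂))

  goodParts-bothEmpty : GoodParts → emptyBorder β₁ ≡ true → emptyBorder β₂ ≡ true → GoodPair (suc n) k i M₁ M₂
  goodParts-bothEmpty p e₁ e₂ = record
    { simplyHooked₁ = record { hookedPP = hookedPP₁ ; size = trans (sym (B₁.entries-N-with k
                                 (cong₂ _+_ no-col₁ no-row₁) (corner-empty admissible₁))) size₁ }
    ; simplyHooked₂ = record { hookedPP = hookedPP₂ ; size = trans (sym (B₂.entries-N-with k
                                 (cong₂ _+_ no-col₂ no-row₂) (corner-empty admissible₂))) size₂ }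
    ; same-lower    = same-lower
    ; lower-size₁   = trans (sym (B₁.entries-lower-N-with no-row₁ (corner-empty admissible₁))) lower-size₁
    ; lower-size₂   = trans (sym (B₂.entries-lower-N-with no-row₂ (corner-empty admissible₂))) lower-size₂
    ; same-columns  = λ y →
        ∨-cancelʳ-false (count≡0⇒none row₁ no-row₁ y) (count≡0⇒none row₂ no-row₂ y) (same-columns y)
    }
    where
    open GoodParts p
    open Admissible using (corner-empty)
    no-col₁ = proj₁ (proj₂ (B₁.emptyBorder-admissible e₁))
    no-row₁ = proj₂ (proj₂ (B₁.emptyBorder-admissible e₁))
    no-col₂ = proj₁ (proj₂ (B₂.emptyBorder-admissible e₂))
    no-row₂ = proj₂ (proj₂ (B₂.emptyBorder-admissible e₂))

  goodParts-bothNewColumn : GoodParts → newColumnEntry Q₁ β₁ ≡ true → newColumnEntry Q₂ β₂ ≡ true →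
                            GoodPair n k i M₁ M₂
  goodParts-bothNewColumn p nc₁ nc₂ = record
    { simplyHooked₁ = record { hookedPP = hookedPP₁ ; size = suc-injective (trans (sym (B₁.entries-N-with k
                                 (cong₂ _+_ one-col₁ no-row₁) (corner-empty admissible₁))) size₁) }
    ; simplyHooked₂ = record { hookedPP = hookedPP₂ ; size = suc-injective (trans (sym (B₂.entries-N-with k
                                 (cong₂ _+_ one-col₂ no-row₂) (corner-empty admissible₂))) size₂) }
    ; same-lower    = same-lower
    ; lower-size₁   = trans (sym (B₁.entries-lower-N-with no-row₁ (corner-empty admissible₁))) lower-size₁
    ; lower-size₂   = trans (sym (B₂.entries-lower-N-with no-row₂ (corner-empty admissible₂))) lower-size₂
    ; same-columns  = λ y →
        ∨-cancelʳ-false (count≡0⇒none row₁ no-row₁ y) (count≡0⇒none row₂ no-row₂ y) (same-columns y)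
    }
    where
    open GoodParts p
    open Admissible using (corner-empty)
    one-col₁ = proj₁ (proj₂ (B₁.newColumnEntry-admissible nc₁))
    no-row₁  = proj₂ (proj₂ (B₁.newColumnEntry-admissible nc₁))
    one-col₂ = proj₁ (proj₂ (B₂.newColumnEntry-admissible nc₂))
    no-row₂  = proj₂ (proj₂ (B₂.newColumnEntry-admissible nc₂))

  goodParts-sharedNewRow : GoodParts → newRowEntry Q₁ β₁ ≡ true → newRowEntry Q₂ β₂ ≡ true →
                       sameRowAs β₁ β₂ ≡ true × i ≡ suc (entries (lower M₁)) × GoodPair n k (entries (lower M₁)) M₁ M₂
  goodParts-sharedNewRow p nr₁ nr₂ = same-row-as , sym suc-e₁≡i , record
    { simplyHooked₁ = record { hookedPP = hookedPP₁ ; size = suc-injective (trans (sym (B₁.entries-N-with k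
                                 (cong₂ _+_ no-col₁ one-row₁) (corner-empty admissible₁))) size₁) }
    ; simplyHooked₂ = record { hookedPP = hookedPP₂ ; size = suc-injective (trans (sym (B₂.entries-N-with k
                                 (cong₂ _+_ no-col₂ one-row₂) (corner-empty admissible₂))) size₂) }
    ; same-lower    = same-lower
    ; lower-size₁   = refl
    ; lower-size₂   = suc-injective (trans (sym (B₂.entries-lower-N-with one-row₂ (corner-empty admissible₂)))
                                           (trans lower-size₂ (sym suc-e₁≡i)))
    ; same-columns  = columns≗
    }
    where
    open GoodParts p
    open Admissible using (corner-empty)
    no-col₁  = proj₁ (proj₂ (B₁.newRowEntry-admissible nr₁))
    one-row₁ = proj₂ (proj₂ (B₁.newRowEntry-admissible nr₁))
    no-col₂  = proj₁ (proj₂ (B₂.newRowEntry-admissible nr₂))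
    one-row₂ = proj₂ (proj₂ (B₂.newRowEntry-admissible nr₂))
    suc-e₁≡i : suc (entries (lower M₁)) ≡ i
    suc-e₁≡i = trans (sym (B₁.entries-lower-N-with one-row₁ (corner-empty admissible₁))) lower-size₁
    same-row-as : sameRowAs β₁ β₂ ≡ true
    same-row-as = cong₂ _∧_ (∧-conicalˡ (isNull c₂) _ nr₂)
      (cong₂ _∧_ (subst (λ v → v ==ᵛ r₁ ≡ true) (lookup-ext r₁ r₂ same-row) (==ᵛ-refl r₁))
                 (cong not (corner-empty admissible₂)))
    single₁ = isSingletonIn-sound (freeCol M₁) r₁ (∧-conicalˡ _ _ (∧-conicalʳ (isNull c₁) _ nr₁))
    j = proj₁ single₁
    columns≗ : ∀ y → occupiedCol M₁ y ≡ occupiedCol M₂ y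
    columns≗ y with y ≟ᶠ j
    ... | yes refl = trans (not-injective (proj₁ (proj₂ single₁)))
                           (sym (anyFin-false λ x → ¬-not (Admissible.row-at-free-col admissible₂ y x
                                                             (trans (sym (same-row y)) (proj₁ (proj₂ (proj₂ single₁)))))))
    ... | no y≢j = ∨-cancelʳ-false row₁-y (trans (sym (same-row y)) row₁-y) (same-columns y)
      where
      row₁-y : row₁ y ≡ false
      row₁-y = ¬-not λ e → y≢j (proj₂ (proj₂ (proj₂ single₁)) y e)

  goodParts-cases : GoodParts → bothEmpty ≡ true ⊎ bothNewColumn ≡ true ⊎ sharedNewRow ≡ true
  goodParts-cases p with B₁.admissible-trichotomy (GoodParts.admissible₁ p)
                      | B₂.admissible-trichotomy (GoodParts.admissible₂ p)
  ... | inj₁ e₁ | inj₁ e₂ =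
    inj₁ (cong₂ _∧_ e₁ (cong₂ _∧_ e₂ (isGoodPair-complete Q₁ Q₂ (goodParts-bothEmpty p e₁ e₂))))
  ... | inj₂ (inj₁ nc₁) | inj₂ (inj₁ nc₂) =
    inj₂ (inj₁ (cong₂ _∧_ nc₁ (cong₂ _∧_ nc₂ (isGoodPair-complete Q₁ Q₂ (goodParts-bothNewColumn p nc₁ nc₂)))))
  ... | inj₂ (inj₂ nr₁) | inj₂ (inj₂ nr₂) =
    let (same-row-as , i≡suc , good) = goodParts-sharedNewRow p nr₁ nr₂
    in inj₂ (inj₂ (cong₂ _∧_ nr₁ (cong₂ _∧_ same-row-as (isGoodPair⁻-complete i Q₁ Q₂ i≡suc good))))
  ... | inj₁ e₁ | inj₂ (inj₁ nc₂) =
    ⊥-elim (shapes-mismatch p (emptyBorder-signature β₁ e₁) (newColumnEntry-signature Q₂ β₂ nc₂) λ ())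
  ... | inj₁ e₁ | inj₂ (inj₂ nr₂) =
    ⊥-elim (shapes-mismatch p (emptyBorder-signature β₁ e₁) (newRowEntry-signature Q₂ β₂ nr₂) λ ())
  ... | inj₂ (inj₁ nc₁) | inj₁ e₂ =
    ⊥-elim (shapes-mismatch p (newColumnEntry-signature Q₁ β₁ nc₁) (emptyBorder-signature β₂ e₂) λ ())
  ... | inj₂ (inj₁ nc₁) | inj₂ (inj₂ nr₂) =
    ⊥-elim (shapes-mismatch p (newColumnEntry-signature Q₁ β₁ nc₁) (newRowEntry-signature Q₂ β₂ nr₂) λ ())
  ... | inj₂ (inj₂ nr₁) | inj₁ e₂ =
    ⊥-elim (shapes-mismatch p (newRowEntry-signature Q₁ β₁ nr₁) (emptyBorder-signature β₂ e₂) λ ())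
  ... | inj₂ (inj₂ nr₁) | inj₂ (inj₁ nc₂) =
    ⊥-elim (shapes-mismatch p (newRowEntry-signature Q₁ β₁ nr₁) (newColumnEntry-signature Q₂ β₂ nc₂) λ ())

  𝟙-isGoodPair-⊞ : 𝟙 (isGoodPair (suc n) k i (Q₁ ⊞ β₁) (Q₂ ⊞ β₂))
                   ≡ 𝟙 bothEmpty + 𝟙 bothNewColumn + 𝟙 sharedNewRow
  𝟙-isGoodPair-⊞ = 𝟙-trichotomy
    (λ h → goodParts-cases (goodParts-sound (isGoodPair-sound (Q₁ ⊞ β₁) (Q₂ ⊞ β₂) h)))
    (λ h → let (e₁ , e₂ , good) = ∧₃-split (emptyBorder β₁) (emptyBorder β₂) h in
           complete (bothEmpty-goodParts e₁ e₂ good))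
    (λ h → let (nc₁ , nc₂ , good) = ∧₃-split (newColumnEntry Q₁ β₁) (newColumnEntry Q₂ β₂) h in
           complete (bothNewColumn-goodParts nc₁ nc₂ good))
    (λ h → let (nr₁ , same , good) = ∧₃-split (newRowEntry Q₁ β₁) (sameRowAs β₁ β₂) h in
           complete (sharedNewRow-goodParts nr₁ same good))
    (λ x y → case trans (sym (emptyBorder-signature β₁ (empty x))) (newColumnEntry-signature Q₁ β₁ (newColumn y)) of λ ())
    (λ x z → case trans (sym (emptyBorder-signature β₁ (empty x))) (newRowEntry-signature Q₁ β₁ (newRow z)) of λ ())
    (λ y z → case trans (sym (newColumnEntry-signature Q₁ β₁ (newColumn y))) (newRowEntry-signature Q₁ β₁ (newRow z)) of λ ())
    where
    complete : GoodParts → isGoodPair (suc n) k i (Q₁ ⊞ β₁) (Q₂ ⊞ β₂) ≡ true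
    complete p = isGoodPair-complete (Q₁ ⊞ β₁) (Q₂ ⊞ β₂) (goodParts-complete p)
    empty : bothEmpty ≡ true → emptyBorder β₁ ≡ true
    empty = ∧-conicalˡ (emptyBorder β₁) _
    newColumn : bothNewColumn ≡ true → newColumnEntry Q₁ β₁ ≡ true
    newColumn = ∧-conicalˡ (newColumnEntry Q₁ β₁) _
    newRow : sharedNewRow ≡ true → newRowEntry Q₁ β₁ ≡ true
    newRow = ∧-conicalˡ (newRowEntry Q₁ β₁) _

count-bothEmpty : (G : Bool) →
  ∑[ β₁ ∈ borders n ] ∑[ β₂ ∈ borders n ] 𝟙 (emptyBorder β₁ ∧ emptyBorder β₂ ∧ G) ≡ 𝟙 G
count-bothEmpty {n} G = begin
  ∑[ β₁ ∈ borders n ] ∑[ β₂ ∈ borders n ] 𝟙 (emptyBorder β₁ ∧ emptyBorder β₂ ∧ G)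
    ≡⟨ count-dependent-∧-const (borders n) (borders n) emptyBorder (λ _ → emptyBorder) G (λ _ → count-emptyBorder {n}) ⟩
  (∑[ β ∈ borders n ] 𝟙 (emptyBorder β)) * (1 * 𝟙 G)
    ≡⟨ cong (_* (1 * 𝟙 G)) (count-emptyBorder {n}) ⟩
  1 * (1 * 𝟙 G)
    ≡⟨ trans (*-identityˡ _) (*-identityˡ _) ⟩
  𝟙 G ∎
  where open ≡-Reasoning

count-bothNewColumn : (Q₁ Q₂ : Rel n) (G : Bool) →
  ∑[ β₁ ∈ borders n ] ∑[ β₂ ∈ borders n ] 𝟙 (newColumnEntry Q₁ β₁ ∧ newColumnEntry Q₂ β₂ ∧ G)
    ≡ count (freeRow (mem Q₁)) * (count (freeRow (mem Q₂)) * 𝟙 G)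
count-bothNewColumn {n} Q₁ Q₂ G =
  trans (count-dependent-∧-const (borders n) (borders n) (newColumnEntry Q₁) (λ _ → newColumnEntry Q₂) G
                                 (λ _ → count-newColumnEntry Q₂))
        (cong (_* (count (freeRow (mem Q₂)) * 𝟙 G)) (count-newColumnEntry Q₁))

count-sharedNewRow : (Q₁ : Rel n) (G : Bool) →
  ∑[ β₁ ∈ borders n ] ∑[ β₂ ∈ borders n ] 𝟙 (newRowEntry Q₁ β₁ ∧ sameRowAs β₁ β₂ ∧ G) ≡ count (freeCol (mem Q₁)) * 𝟙 G
count-sharedNewRow {n} Q₁ G =
  trans (count-dependent-∧-const (borders n) (borders n) (newRowEntry Q₁) sameRowAs G count-sameRowAs)
        (cong₂ _*_ (count-newRowEntry Q₁) (*-identityˡ (𝟙 G)))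

-- A new entry sits in one of the k free rows, chosen independently for Q₁ and Q₂, or in one of
-- the k free columns, the same for both since Q₁⁻ = Q₂⁻.
border-count : (k i : ℕ) (Q₁ Q₂ : Rel n) →
  ∑[ β₁ ∈ borders n ] ∑[ β₂ ∈ borders n ] 𝟙 (isGoodPair (suc n) k i (Q₁ ⊞ β₁) (Q₂ ⊞ β₂))
    ≡ 𝟙 (isGoodPair (suc n) k i Q₁ Q₂) + k * (k * 𝟙 (isGoodPair n k i Q₁ Q₂)) + k * 𝟙 (isGoodPair⁻ n k i Q₁ Q₂)
border-count {n} k i Q₁ Q₂ = begin
  ∑∑ (λ β₁ β₂ → 𝟙 (isGoodPair (suc n) k i (Q₁ ⊞ β₁) (Q₂ ⊞ β₂)))
    ≡⟨ sumOver-cong (borders n) (λ (c₁ , r₁ , b₁) → sumOver-cong (borders n) λ (c₂ , r₂ , b₂) →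
         BorderedPair.𝟙-isGoodPair-⊞ k i Q₁ Q₂ c₁ r₁ b₁ c₂ r₂ b₂) ⟩
  ∑∑ (λ β₁ β₂ → 𝟙 (E β₁ β₂) + 𝟙 (C β₁ β₂) + 𝟙 (R β₁ β₂))
    ≡⟨ sumOver²-distrib-+ (borders n) (borders n) _ _ ⟩
  ∑∑ (λ β₁ β₂ → 𝟙 (E β₁ β₂) + 𝟙 (C β₁ β₂)) + ∑∑ (λ β₁ β₂ → 𝟙 (R β₁ β₂))
    ≡⟨ cong (_+ ∑∑ (λ β₁ β₂ → 𝟙 (R β₁ β₂))) (sumOver²-distrib-+ (borders n) (borders n) _ _) ⟩
  ∑∑ (λ β₁ β₂ → 𝟙 (E β₁ β₂)) + ∑∑ (λ β₁ β₂ → 𝟙 (C β₁ β₂)) + ∑∑ (λ β₁ β₂ → 𝟙 (R β₁ β₂))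
    ≡⟨ cong₂ _+_ (cong₂ _+_ (count-bothEmpty {n} G) (count-bothNewColumn Q₁ Q₂ G′)) (count-sharedNewRow Q₁ G⁻) ⟩
  𝟙 G + count (freeRow (mem Q₁)) * (count (freeRow (mem Q₂)) * 𝟙 G′) + count (freeCol (mem Q₁)) * 𝟙 G⁻
    ≡⟨ cong₂ (λ x y → 𝟙 G + x + y) free-rows free-cols ⟩
  𝟙 G + k * (k * 𝟙 G′) + k * 𝟙 G⁻ ∎
  where
  open ≡-Reasoning
  G G′ G⁻ : Bool
  G  = isGoodPair (suc n) k i Q₁ Q₂
  G′ = isGoodPair n k i Q₁ Q₂
  G⁻ = isGoodPair⁻ n k i Q₁ Q₂
  E C R : Border n → Border n → Bool
  E β₁ β₂ = emptyBorder β₁ ∧ emptyBorder β₂ ∧ G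
  C β₁ β₂ = newColumnEntry Q₁ β₁ ∧ newColumnEntry Q₂ β₂ ∧ G′
  R β₁ β₂ = newRowEntry Q₁ β₁ ∧ sameRowAs β₁ β₂ ∧ G⁻
  ∑∑ : (Border n → Border n → ℕ) → ℕ
  ∑∑ f = ∑[ β₁ ∈ borders n ] ∑[ β₂ ∈ borders n ] f β₁ β₂
  free-rows : count (freeRow (mem Q₁)) * (count (freeRow (mem Q₂)) * 𝟙 G′) ≡ k * (k * 𝟙 G′)
  free-rows = trans (sym (*-assoc (count (freeRow (mem Q₁))) (count (freeRow (mem Q₂))) (𝟙 G′)))
    (trans (*-𝟙-cong G′ λ good → let open GoodPair (isGoodPair-sound Q₁ Q₂ good) in
                                 cong₂ _*_ (count-freeRow simplyHooked₁) (count-freeRow simplyHooked₂))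
           (*-assoc k k (𝟙 G′)))
  free-cols : count (freeCol (mem Q₁)) * 𝟙 G⁻ ≡ k * 𝟙 G⁻
  free-cols = *-𝟙-cong G⁻ λ good →
    count-freeCol (GoodPair.simplyHooked₁ (proj₂ (proj₂ (isGoodPair⁻-sound {m = n} {k = k} i Q₁ Q₂ good))))

-- The recurrence

prev : (ℕ → ℕ) → ℕ → ℕ
prev f zero    = 0
prev f (suc i) = f i

prev-cong : {f g : ℕ → ℕ} → (∀ i → f i ≡ g i) → ∀ i → prev f i ≡ prev g i
prev-cong f≗g zero    = refl
prev-cong f≗g (suc i) = f≗g i

sumOver-isGoodPair⁻ : (n k i : ℕ) →
  ∑[ Q₁ ∈ allRels n ] ∑[ Q₂ ∈ allRels n ] 𝟙 (isGoodPair⁻ n k i Q₁ Q₂) ≡ prev (pairCount n n k) i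
sumOver-isGoodPair⁻ n k zero    = trans (sumOver-cong (allRels n) λ _ → sumOver-zero (allRels n)) (sumOver-zero (allRels n))
sumOver-isGoodPair⁻ n k (suc i) = refl

sumOver-allRels²-suc : (f : Rel (suc n) → Rel (suc n) → ℕ) →
  ∑[ R₁ ∈ allRels (suc n) ] ∑[ R₂ ∈ allRels (suc n) ] f R₁ R₂
    ≡ ∑[ Q₁ ∈ allRels n ] ∑[ Q₂ ∈ allRels n ] ∑[ β₁ ∈ borders n ] ∑[ β₂ ∈ borders n ] f (Q₁ ⊞ β₁) (Q₂ ⊞ β₂)
sumOver-allRels²-suc {n} f = begin
  ∑[ R₁ ∈ allRels (suc n) ] ∑[ R₂ ∈ allRels (suc n) ] f R₁ R₂
    ≡⟨ sumOver-allRels-suc (λ R₁ → ∑[ R₂ ∈ allRels (suc n) ] f R₁ R₂) ⟩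
  ∑[ Q₁ ∈ allRels n ] ∑[ β₁ ∈ borders n ] ∑[ R₂ ∈ allRels (suc n) ] f (Q₁ ⊞ β₁) R₂
    ≡⟨ sumOver-cong (allRels n) (λ Q₁ → sumOver-cong (borders n) λ β₁ → sumOver-allRels-suc (f (Q₁ ⊞ β₁))) ⟩
  ∑[ Q₁ ∈ allRels n ] ∑[ β₁ ∈ borders n ] ∑[ Q₂ ∈ allRels n ] ∑[ β₂ ∈ borders n ] f (Q₁ ⊞ β₁) (Q₂ ⊞ β₂)
    ≡⟨ sumOver-cong (allRels n) (λ Q₁ → sumOver-comm (borders n) (allRels n) _) ⟩
  ∑[ Q₁ ∈ allRels n ] ∑[ Q₂ ∈ allRels n ] ∑[ β₁ ∈ borders n ] ∑[ β₂ ∈ borders n ] f (Q₁ ⊞ β₁) (Q₂ ⊞ β₂) ∎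
  where open ≡-Reasoning

pairCount-suc : (n k i : ℕ) →
  pairCount (suc n) (suc n) k i ≡ pairCount (suc n) n k i + k * (k * pairCount n n k i) + k * prev (pairCount n n k) i
pairCount-suc n k i = begin
  pairCount (suc n) (suc n) k i
    ≡⟨ sumOver-allRels²-suc {n} (λ R₁ R₂ → 𝟙 (isGoodPair (suc n) k i R₁ R₂)) ⟩
  ∑∑ (λ Q₁ Q₂ → ∑[ β₁ ∈ borders n ] ∑[ β₂ ∈ borders n ] 𝟙 (isGoodPair (suc n) k i (Q₁ ⊞ β₁) (Q₂ ⊞ β₂)))
    ≡⟨ sumOver-cong (allRels n) (λ Q₁ → sumOver-cong (allRels n) λ Q₂ → border-count k i Q₁ Q₂) ⟩
  ∑∑ (λ Q₁ Q₂ → G Q₁ Q₂ + k * (k * G′ Q₁ Q₂) + k * G⁻ Q₁ Q₂)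
    ≡⟨ sumOver²-distrib-+ (allRels n) (allRels n) _ _ ⟩
  ∑∑ (λ Q₁ Q₂ → G Q₁ Q₂ + k * (k * G′ Q₁ Q₂)) + ∑∑ (λ Q₁ Q₂ → k * G⁻ Q₁ Q₂)
    ≡⟨ cong₂ _+_ (sumOver²-distrib-+ (allRels n) (allRels n) _ _) (sym (*-distribˡ-sumOver² k (allRels n) (allRels n) G⁻)) ⟩
  ∑∑ G + ∑∑ (λ Q₁ Q₂ → k * (k * G′ Q₁ Q₂)) + k * ∑∑ G⁻
    ≡⟨ cong₂ (λ x y → ∑∑ G + x + k * y)
             (trans (sym (*-distribˡ-sumOver² k (allRels n) (allRels n) _))
                    (cong (k *_) (sym (*-distribˡ-sumOver² k (allRels n) (allRels n) G′))))
             (sumOver-isGoodPair⁻ n k i) ⟩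
  pairCount (suc n) n k i + k * (k * pairCount n n k i) + k * prev (pairCount n n k) i ∎
  where
  open ≡-Reasoning
  ∑∑ : (Rel n → Rel n → ℕ) → ℕ
  ∑∑ f = ∑[ Q₁ ∈ allRels n ] ∑[ Q₂ ∈ allRels n ] f Q₁ Q₂
  G G′ G⁻ : Rel n → Rel n → ℕ
  G  Q₁ Q₂ = 𝟙 (isGoodPair (suc n) k i Q₁ Q₂)
  G′ Q₁ Q₂ = 𝟙 (isGoodPair n k i Q₁ Q₂)
  G⁻ Q₁ Q₂ = 𝟙 (isGoodPair⁻ n k i Q₁ Q₂)

pairCount-shift : (m n k i : ℕ) → pairCount (suc m) n (suc k) i ≡ pairCount m n k i
pairCount-shift m n k i = sumOver-cong (allRels n) λ Q₁ → sumOver-cong (allRels n) λ Q₂ → cong 𝟙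
  (isGoodPairBy-cong _ _ i (λ e → ⌊⌋-cong (e + suc k ≟ suc m) (e + k ≟ m)
                               (λ h → suc-injective (trans (sym (+-suc e k)) h))
                               (λ h → trans (+-suc e k) (cong suc h))) Q₁ Q₂)

pairCount-too-large : (n i : ℕ) → pairCount (suc n) n 0 i ≡ 0
pairCount-too-large n i =
  trans (sumOver-cong (allRels n) λ Q₁ →
           trans (sumOver-cong (allRels n) λ Q₂ → cong 𝟙 (impossible Q₁ Q₂)) (sumOver-zero (allRels n)))
        (sumOver-zero (allRels n))
  where
  impossible : (Q₁ Q₂ : Rel n) → isGoodPair (suc n) 0 i Q₁ Q₂ ≡ false
  impossible Q₁ Q₂ = ¬-not λ good → SimplyHooked-too-large (GoodPair.simplyHooked₁ (isGoodPair-sound Q₁ Q₂ good))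

countPairs≡pairCount : {n k : ℕ} (i : ℕ) → k ≤ n → countPairs n k i ≡ pairCount n n k i
countPairs≡pairCount {n} {k} i k≤n = begin
  countPairs n k i
    ≡⟨ length-filter≡count (cartesianProduct (allRels n) (allRels n)) (λ (Q₁ , Q₂) → goodPair n k i Q₁ Q₂) ⟩
  ∑[ (Q₁ , Q₂) ∈ cartesianProduct (allRels n) (allRels n) ] 𝟙 (goodPair n k i Q₁ Q₂)
    ≡⟨ sumOver-cartesianProduct (allRels n) (allRels n) _ ⟩
  ∑[ Q₁ ∈ allRels n ] ∑[ Q₂ ∈ allRels n ] 𝟙 (goodPair n k i Q₁ Q₂)
    ≡⟨ sumOver-cong (allRels n) (λ Q₁ → sumOver-cong (allRels n) λ Q₂ → cong 𝟙 (isGoodPairBy-cong _ _ i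
         (λ e → ⌊⌋-cong (e ≟ n ∸ k) (e + k ≟ n)
                  (λ e≡n∸k → trans (cong (_+ k) e≡n∸k) (m∸n+n≡m k≤n))
                  (λ e+k≡n → trans (sym (m+n∸n≡m e k)) (cong (_∸ k) e+k≡n))) Q₁ Q₂)) ⟩
  pairCount n n k i ∎
  where open ≡-Reasoning

coeff-⊕ : (p q : Poly) (i : ℕ) → coeff (p ⊕ q) i ≡ coeff p i + coeff q i
coeff-⊕ []      q       i       = refl
coeff-⊕ (x ∷ p) []      zero    = sym (+-identityʳ x)
coeff-⊕ (x ∷ p) []      (suc i) = sym (+-identityʳ _)
coeff-⊕ (x ∷ p) (y ∷ q) zero    = refl
coeff-⊕ (x ∷ p) (y ∷ q) (suc i) = coeff-⊕ p q i

coeff-scale : (c : ℕ) (p : Poly) (i : ℕ) → coeff (scale c p) i ≡ c * coeff p i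
coeff-scale c []      i       = sym (*-zeroʳ c)
coeff-scale c (x ∷ p) zero    = refl
coeff-scale c (x ∷ p) (suc i) = coeff-scale c p i

coeff-shiftZ : (p : Poly) (i : ℕ) → coeff (shiftZ p) i ≡ prev (coeff p) i
coeff-shiftZ p zero    = refl
coeff-shiftZ p (suc i) = refl

a-suc : (n k i : ℕ) → a (suc n) (suc k) i ≡ a n k i + suc k * suc k * a n (suc k) i + suc k * prev (a n (suc k)) i
a-suc n k i = begin
  coeff (JS n k ⊕ (scale (suc k * suc k) (JS n (suc k)) ⊕ scale (suc k) (shiftZ (JS n (suc k))))) i
    ≡⟨ coeff-⊕ (JS n k) _ i ⟩
  a n k i + coeff (scale (suc k * suc k) (JS n (suc k)) ⊕ scale (suc k) (shiftZ (JS n (suc k)))) i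
    ≡⟨ cong (a n k i +_) (coeff-⊕ (scale (suc k * suc k) (JS n (suc k))) _ i) ⟩
  a n k i + (coeff (scale (suc k * suc k) (JS n (suc k))) i + coeff (scale (suc k) (shiftZ (JS n (suc k)))) i)
    ≡⟨ cong (a n k i +_) (cong₂ _+_ (coeff-scale (suc k * suc k) (JS n (suc k)) i)
                                      (trans (coeff-scale (suc k) (shiftZ (JS n (suc k))) i)
                                             (cong (suc k *_) (coeff-shiftZ (JS n (suc k)) i)))) ⟩
  a n k i + (suc k * suc k * a n (suc k) i + suc k * prev (a n (suc k)) i)
    ≡⟨ +-assoc (a n k i) _ _ ⟨
  a n k i + suc k * suc k * a n (suc k) i + suc k * prev (a n (suc k)) i ∎
  where open ≡-Reasoning

a≡pairCount : (n k i : ℕ) → a n k i ≡ pairCount n n k i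
a≡pairCount zero    zero    zero    = refl
a≡pairCount zero    zero    (suc i) = refl
a≡pairCount zero    (suc k) i       = refl
a≡pairCount (suc n) zero    i       = sym (trans (pairCount-suc n 0 i) (cong (λ x → x + 0 + 0) (pairCount-too-large n i)))
a≡pairCount (suc n) (suc k) i = begin
  a (suc n) (suc k) i
    ≡⟨ a-suc n k i ⟩
  a n k i + suc k * suc k * a n (suc k) i + suc k * prev (a n (suc k)) i
    ≡⟨ cong₂ _+_ (cong₂ (λ x y → x + suc k * suc k * y) (a≡pairCount n k i) (a≡pairCount n (suc k) i))
                 (cong (suc k *_) (prev-cong (a≡pairCount n (suc k)) i)) ⟩
  pairCount n n k i + suc k * suc k * pairCount n n (suc k) i + suc k * prev (pairCount n n (suc k)) i
    ≡⟨ cong₂ (λ x y → x + y + suc k * prev (pairCount n n (suc k)) i)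
             (sym (pairCount-shift n n k i)) (*-assoc (suc k) (suc k) _) ⟩
  pairCount (suc n) n (suc k) i + suc k * (suc k * pairCount n n (suc k) i) + suc k * prev (pairCount n n (suc k)) i
    ≡⟨ pairCount-suc n (suc k) i ⟨
  pairCount (suc n) (suc n) (suc k) i ∎
  where open ≡-Reasoning

-- The identity holds for all n, k, i with k ≤ n.
theorem4 : (n k i : ℕ) → 1 ≤ k → k ≤ n → 1 ≤ i → i ≤ n ∸ k →
    a n k i ≡ countPairs n k i
theorem4 n k i _ k≤n _ _ = trans (a≡pairCount n k i) (sym (countPairs≡pairCount i k≤n))
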